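{- Let $G$ be a finite simple graph that contains one of the configurations (a), (b), (c), (d) described below via an injection $f$, and suppose that the graph obtained from $G$ by the 2-switch on $\langle f(p),f(q):f(r),f(s)\rangle$ is isomorphic to $G$. Then $G$ contains one of the configurations (A), (B) described below via an injection $g$ whose image contains the image of $f$ and such that the alternating 4-cycle $\langle g(u),g(v):g(w),g(x)\rangle$ coincides with $\langle f(p),f(q):f(r),f(s)\rangle$, i.e. $\{\{g(u),g(v)\},\{g(w),g(x)\}\}=\{\{f(p),f(q)\},\{f(r),f(s)\}\}$ and $\{\{g(v),g(w)\},\{g(u),g(x)\}\}=\{\{f(q),f(r)\},\{f(p),f(s)\}\}$.
   Context: All graphs are finite and simple. An alternating 4-cycle $\langle a,b:c,d\rangle$ in a graph consists of four distinct vertices with $ab,cd$ edges and $bc,ad$ non-edges; the 2-switch on it deletes $ab,cd$ and adds $bc,ad$. A configuration is a triple $(V,E,F)$ with $(V,E)$ a graph and $F$ a set of vertex pairs not in $E$ (non-edges). A graph $G$ contains $(V,E,F)$ via an injection $f:V\to V(G)$ if $f(x)f(y)\in E(G)$ for all $xy\in E$ and $f(x)f(y)\notin E(G)$ for all $xy\in F$ (other pairs unconstrained). The configurations are: (a) vertices $p,q,r,s,w$; edges $pq,rs,qw,rw$; non-edges $qr,ps,pw,sw$. (b) vertices $p,q,r,s,w$; edges $pq,rs,pw,qw$; non-edges $qr,ps,rw,sw$. (c) vertices $p,q,r,s,y,z$; edges $pq,rs,pz,qy$; non-edges $qr,ps,rz,sy$. (d) vertices $p,q,r,s,y,z$; edges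 $pq,rs,ry,qz$; non-edges $qr,ps,py,sz$. (A) vertices $u,v,w,x,y,z$; edges $uv,wx,vy,wy,uz,vz$; non-edges $vw,ux,uy,xy,wz,xz$. (B) vertices $u,v,w,x,y,z,t$; edges $uv,wx,vy,uz,wt$; non-edges $vw,ux,xy,wz,ut$. -}

module Defs where

open import Data.Nat using (ℕ)
open import Data.Bool using (Bool; true; false; _∧_; _∨_; if_then_else_)
open import Data.Fin using (Fin; #_; _≟_)
open import Data.Product using (Σ; ∃; _×_; _,_; proj₁; proj₂)
open import Data.Sum using (_⊎_)
open import Data.List using (List; []; _∷_)
open import Data.List.Relation.Unary.All using (All)
open import Relation.Nullary.Decidable using (⌊_⌋)
open import Relation.Binary.PropositionalEquality using (_≡_)
open import Function.Definitions using (Injective)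
open import Function.Bundles using (_↔_; Inverse)

record Graph (n : ℕ) : Set where
  field
    adj    : Fin n → Fin n → Bool
    sym    : ∀ x y → adj x y ≡ adj y x
    irrefl : ∀ x → adj x x ≡ false
open Graph public

samePair? : ∀ {n} → Fin n → Fin n → Fin n → Fin n → Bool
samePair? x y a b = (⌊ x ≟ a ⌋ ∧ ⌊ y ≟ b ⌋) ∨ (⌊ x ≟ b ⌋ ∧ ⌊ y ≟ a ⌋)

switchAdj : ∀ {n} → (Fin n → Fin n → Bool) → Fin n → Fin n → Fin n → Fin n →
            Fin n → Fin n → Bool
switchAdj e a b c d x y =
  if samePair? x y a b ∨ samePair? x y c d then false
  else if samePair? x y b c ∨ samePair? x y a d then true
  else e x y

Isomorphic : ∀ {n} → (Fin n → Fin n → Bool) → (Fin n → Fin n → Bool) → Set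
Isomorphic {n} e₁ e₂ =
  Σ (Fin n ↔ Fin n) λ σ → ∀ x y → e₂ (Inverse.to σ x) (Inverse.to σ y) ≡ e₁ x y

-- Configurations (V, E, F) with V = Fin size, plus four distinguished
-- vertices naming the alternating 4-cycle ⟨c₁,c₂:c₃,c₄⟩
-- ((p,q,r,s) for (a)-(d), (u,v,w,x) for (A),(B)).

record Config : Set where
  field
    size     : ℕ
    edges    : List (Fin size × Fin size)
    nonEdges : List (Fin size × Fin size)
    c₁ c₂ c₃ c₄ : Fin size
open Config public

Contains : ∀ {n} → Graph n → (C : Config) → (Fin (size C) → Fin n) → Set
Contains G C f =
  Injective _≡_ _≡_ f ×
  All (λ e → adj G (f (proj₁ e)) (f (proj₂ e)) ≡ true)  (edges C) ×
  All (λ e → adj G (f (proj₁ e)) (f (proj₂ e)) ≡ false) (nonEdges C)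

-- (a): p q r s w = 0 1 2 3 4; edges pq,rs,qw,rw; non-edges qr,ps,pw,sw
conf-a : Config
conf-a = record
  { size = 5
  ; edges    = (# 0 , # 1) ∷ (# 2 , # 3) ∷ (# 1 , # 4) ∷ (# 2 , # 4) ∷ []
  ; nonEdges = (# 1 , # 2) ∷ (# 0 , # 3) ∷ (# 0 , # 4) ∷ (# 3 , # 4) ∷ []
  ; c₁ = # 0 ; c₂ = # 1 ; c₃ = # 2 ; c₄ = # 3 }

-- (b): p q r s w = 0 1 2 3 4; edges pq,rs,pw,qw; non-edges qr,ps,rw,sw
conf-b : Config
conf-b = record
  { size = 5
  ; edges    = (# 0 , # 1) ∷ (# 2 , # 3) ∷ (# 0 , # 4) ∷ (# 1 , # 4) ∷ []
  ; nonEdges = (# 1 , # 2) ∷ (# 0 , # 3) ∷ (# 2 , # 4) ∷ (# 3 , # 4) ∷ []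
  ; c₁ = # 0 ; c₂ = # 1 ; c₃ = # 2 ; c₄ = # 3 }

-- (c): p q r s y z = 0 1 2 3 4 5; edges pq,rs,pz,qy; non-edges qr,ps,rz,sy
conf-c : Config
conf-c = record
  { size = 6
  ; edges    = (# 0 , # 1) ∷ (# 2 , # 3) ∷ (# 0 , # 5) ∷ (# 1 , # 4) ∷ []
  ; nonEdges = (# 1 , # 2) ∷ (# 0 , # 3) ∷ (# 2 , # 5) ∷ (# 3 , # 4) ∷ []
  ; c₁ = # 0 ; c₂ = # 1 ; c₃ = # 2 ; c₄ = # 3 }

-- (d): p q r s y z = 0 1 2 3 4 5; edges pq,rs,ry,qz; non-edges qr,ps,py,sz
conf-d : Config
conf-d = record
  { size = 6
  ; edges    = (# 0 , # 1) ∷ (# 2 , # 3) ∷ (# 2 , # 4) ∷ (# 1 , # 5) ∷ []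
  ; nonEdges = (# 1 , # 2) ∷ (# 0 , # 3) ∷ (# 0 , # 4) ∷ (# 3 , # 5) ∷ []
  ; c₁ = # 0 ; c₂ = # 1 ; c₃ = # 2 ; c₄ = # 3 }

-- (A): u v w x y z = 0 1 2 3 4 5;
--   edges uv,wx,vy,wy,uz,vz; non-edges vw,ux,uy,xy,wz,xz
conf-A : Config
conf-A = record
  { size = 6
  ; edges    = (# 0 , # 1) ∷ (# 2 , # 3) ∷ (# 1 , # 4) ∷ (# 2 , # 4) ∷
               (# 0 , # 5) ∷ (# 1 , # 5) ∷ []
  ; nonEdges = (# 1 , # 2) ∷ (# 0 , # 3) ∷ (# 0 , # 4) ∷ (# 3 , # 4) ∷
               (# 2 , # 5) ∷ (# 3 , # 5) ∷ []
  ; c₁ = # 0 ; c₂ = # 1 ; c₃ = # 2 ; c₄ = # 3 }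

-- (B): u v w x y z t = 0 1 2 3 4 5 6;
--   edges uv,wx,vy,uz,wt; non-edges vw,ux,xy,wz,ut
conf-B : Config
conf-B = record
  { size = 7
  ; edges    = (# 0 , # 1) ∷ (# 2 , # 3) ∷ (# 1 , # 4) ∷ (# 0 , # 5) ∷
               (# 2 , # 6) ∷ []
  ; nonEdges = (# 1 , # 2) ∷ (# 0 , # 3) ∷ (# 3 , # 4) ∷ (# 2 , # 5) ∷
               (# 0 , # 6) ∷ []
  ; c₁ = # 0 ; c₂ = # 1 ; c₃ = # 2 ; c₄ = # 3 }

data SmallConfig : Config → Set where
  is-a : SmallConfig conf-a
  is-b : SmallConfig conf-b
  is-c : SmallConfig conf-c
  is-d : SmallConfig conf-d

data BigConfig : Config → Set where
  is-A : BigConfig conf-A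
  is-B : BigConfig conf-B

PairEq : ∀ {n} → Fin n → Fin n → Fin n → Fin n → Set
PairEq a b a' b' = (a ≡ a' × b ≡ b') ⊎ (a ≡ b' × b ≡ a')

PairSetEq : ∀ {n} → Fin n → Fin n → Fin n → Fin n →
                    Fin n → Fin n → Fin n → Fin n → Set
PairSetEq a b c d a' b' c' d' =
  (PairEq a b a' b' × PairEq c d c' d') ⊎ (PairEq a b c' d' × PairEq c d a' b')

ImageSub : ∀ {n k l} → (Fin k → Fin n) → (Fin l → Fin n) → Set
ImageSub f g = ∀ i → ∃ λ j → g j ≡ f i

SameCycle : ∀ {n} (C D : Config) → (Fin (size C) → Fin n) → (Fin (size D) → Fin n) → Set
SameCycle C D f g =
  PairSetEq (g (c₁ D)) (g (c₂ D)) (g (c₃ D)) (g (c₄ D))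
            (f (c₁ C)) (f (c₂ C)) (f (c₃ C)) (f (c₄ C)) ×
  PairSetEq (g (c₂ D)) (g (c₃ D)) (g (c₁ D)) (g (c₄ D))
            (f (c₂ C)) (f (c₃ C)) (f (c₁ C)) (f (c₄ C))

module Submission where

open import Defs hiding (sym)
open import Data.Nat using (ℕ)
open import Data.Fin using (Fin)
open import Data.Product using (Σ; _×_)

open import Data.Bool using (Bool; true; false; _∧_; _∨_; not; if_then_else_)
open import Data.Bool.Properties using (∧-comm; ∨-comm; ∧-idem; ∧-zeroʳ; ∨-zeroʳ) renaming (_≟_ to _≟ᵇ_)
open import Data.Empty using (⊥; ⊥-elim)
open import Data.Fin using (zero; suc; _≟_; punchIn; _↑ʳ_)
open import Data.Fin.Patterns using (0F; 1F; 2F; 3F; 4F; 5F; 6F)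
open import Data.Fin.Properties using (any?; punchInᵢ≢i)
open import Data.List.Relation.Unary.All using (_∷_; [])
open import Data.Nat using (zero; suc; _+_; _*_; _≤_; _<_; z≤n; s≤s)
open import Data.Nat.Properties hiding (_≟_)
open import Data.Nat.Tactic.RingSolver using (solve-∀)
open import Algebra.Properties.Semiring.Sum +-*-semiring
  using (sum; sum-syntax; ∑-distrib-+; ∑-comm; ∑-permute; *-distribˡ-sum; sum-cong-≗; sum-remove; sum-replicate-zero)
open import Data.Product using (∃; _,_; proj₁; proj₂; map₂)
open import Data.Sum using (_⊎_; inj₁; inj₂; map₁)
open import Data.Vec using (_∷_; []; lookup)
open import Data.Vec.Relation.Unary.All using (_∷_; [])
open import Data.Vec.Relation.Unary.Unique.Propositional using (Unique; _∷_; [])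
open import Data.Vec.Relation.Unary.Unique.Propositional.Properties using (lookup-injective)
open import Function using (_∘_)
open import Function.Bundles using (_↔_; Inverse)
open import Function.Definitions using (Injective)
open import Relation.Nullary using (yes; no; ¬?)
open import Relation.Nullary.Decidable using (⌊_⌋; isYes≗does; dec-true; dec-false; _×-dec_)
open import Relation.Binary.PropositionalEquality

-- Write G′ for the 2-switch of G on ⟨p,q:r,s⟩ and M for the common edges of G and G′, so that as
-- 0/1 matrices G = M + {pq, rs} and G′ = M + {qr, ps}. Adding a perfect matching {ab, cd} to M adds
-- 6 (codeg_M(a,b) + codeg_M(c,d)) ordered triangles, and these codegrees only count vertices outside
-- the cycle. As G ≅ G′ have equally many triangles, the outside vertices adjacent to both ends of pq
-- or of rs are as many as those adjacent to both ends of qr or of ps. The switch keeps every degree d,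
-- so ∑_{xy ∈ E} d(x) d(y) is the same for G and G′; the two sums differ by 2 (d(p) − d(r)) (d(q) − d(s)),
-- hence outside the cycle |N(p) ∖ N(r)| = |N(r) ∖ N(p)| or |N(q) ∖ N(s)| = |N(s) ∖ N(q)|.
-- In (a) and (b) the first balance turns the extra vertex into a second one completing (A). In (c)
-- and (d) the second balance either provides a third vertex for (B), or makes both differences
-- singletons, and then the first balance completes (A).

-- Finite sums

toℕ : Bool → ℕ
toℕ true  = 1
toℕ false = 0

≟-refl : ∀ {n} (a : Fin n) → ⌊ a ≟ a ⌋ ≡ true
≟-refl a = trans (isYes≗does (a ≟ a)) (dec-true (a ≟ a) refl)

δ : ∀ {n} → Fin n → Fin n → ℕ
δ x a = toℕ ⌊ x ≟ a ⌋

δ-refl : ∀ {n} (a : Fin n) → δ a a ≡ 1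
δ-refl a = cong toℕ (≟-refl a)

δ-≢ : ∀ {n} {x a : Fin n} → x ≢ a → δ x a ≡ 0
δ-≢ {x = x} {a} x≢a = cong toℕ (trans (isYes≗does (x ≟ a)) (dec-false (x ≟ a) x≢a))

∑-zero : ∀ {n} {f : Fin n → ℕ} → (∀ i → f i ≡ 0) → ∑[ i < n ] f i ≡ 0
∑-zero {n} f≡0 = trans (sum-cong-≗ f≡0) (sum-replicate-zero n)

∑-δ : ∀ {n} (a : Fin n) (h : Fin n → ℕ) → ∑[ x < n ] (δ x a * h x) ≡ h a
∑-δ {suc n} a h = begin
  ∑[ x < suc n ] (δ x a * h x)                            ≡⟨ sum-remove {i = a} (λ x → δ x a * h x) ⟩
  δ a a * h a + ∑[ j < n ] (δ (punchIn a j) a * h (punchIn a j))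
    ≡⟨ cong₂ _+_ (cong (_* h a) (δ-refl a)) (∑-zero λ j → cong (_* h (punchIn a j)) (δ-≢ (punchInᵢ≢i a j))) ⟩
  1 * h a + 0                                             ≡⟨ trans (+-identityʳ _) (*-identityˡ _) ⟩
  h a                                                     ∎
  where open ≡-Reasoning

∑-δ₁ : ∀ {n} (a : Fin n) → ∑[ x < n ] δ x a ≡ 1
∑-δ₁ a = trans (sum-cong-≗ λ x → sym (*-identityʳ (δ x a))) (∑-δ a (λ _ → 1))

∑-distrib₄ : ∀ {n} (f g k l : Fin n → ℕ) →
             ∑[ i < n ] (f i + g i + (k i + l i)) ≡ ∑[ i < n ] f i + ∑[ i < n ] g i + (∑[ i < n ] k i + ∑[ i < n ] l i)
∑-distrib₄ f g k l =
  trans (∑-distrib-+ (λ i → f i + g i) (λ i → k i + l i)) (cong₂ _+_ (∑-distrib-+ f g) (∑-distrib-+ k l))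

∑-mono-≤ : ∀ {n} {f g : Fin n → ℕ} → (∀ i → f i ≤ g i) → ∑[ i < n ] f i ≤ ∑[ i < n ] g i
∑-mono-≤ {zero}  f≤g = z≤n
∑-mono-≤ {suc n} f≤g = +-mono-≤ (f≤g zero) (∑-mono-≤ (f≤g ∘ suc))

∑-mono-< : ∀ {n} {f g : Fin n → ℕ} → (∀ i → f i ≤ g i) → ∀ w → f w < g w → ∑[ i < n ] f i < ∑[ i < n ] g i
∑-mono-< {suc n} f≤g zero    fw<gw = +-mono-<-≤ fw<gw (∑-mono-≤ (f≤g ∘ suc))
∑-mono-< {suc n} f≤g (suc w) fw<gw = +-mono-≤-< (f≤g zero) (∑-mono-< (f≤g ∘ suc) w fw<gw)

∑≡∑∧<⇒> : ∀ {n} {f g : Fin n → ℕ} → ∑[ i < n ] f i ≡ ∑[ i < n ] g i → ∀ w → f w < g w → ∃ λ z → g z < f z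
∑≡∑∧<⇒> {f = f} {g} ∑f≡∑g w fw<gw with any? (λ z → g z <? f z)
... | yes gz<fz = gz<fz
... | no  ∄gz<fz = ⊥-elim (<-irrefl ∑f≡∑g (∑-mono-< (λ i → ≮⇒≥ (λ gi<fi → ∄gz<fz (i , gi<fi))) w fw<gw))

module _ {n : ℕ} where

  ∑² : (Fin n → Fin n → ℕ) → ℕ
  ∑² f = ∑[ x < n ] ∑[ y < n ] f x y

  ∑²-cong : ∀ {f g : Fin n → Fin n → ℕ} → (∀ x y → f x y ≡ g x y) → ∑² f ≡ ∑² g
  ∑²-cong f≡g = sum-cong-≗ λ x → sum-cong-≗ (f≡g x)

  ∑²-distrib-+ : ∀ (f g : Fin n → Fin n → ℕ) → ∑² (λ x y → f x y + g x y) ≡ ∑² f + ∑² g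
  ∑²-distrib-+ f g =
    trans (sum-cong-≗ λ x → ∑-distrib-+ (f x) (g x)) (∑-distrib-+ (λ x → ∑[ y < n ] f x y) (λ x → ∑[ y < n ] g x y))

  ∑³ : (Fin n → Fin n → Fin n → ℕ) → ℕ
  ∑³ f = ∑[ x < n ] ∑² (f x)

  ∑³-cong : ∀ {f g : Fin n → Fin n → Fin n → ℕ} → (∀ x y z → f x y z ≡ g x y z) → ∑³ f ≡ ∑³ g
  ∑³-cong f≡g = sum-cong-≗ λ x → ∑²-cong (f≡g x)

  ∑³-distrib-+ : ∀ (f g : Fin n → Fin n → Fin n → ℕ) → ∑³ (λ x y z → f x y z + g x y z) ≡ ∑³ f + ∑³ g
  ∑³-distrib-+ f g = trans (sum-cong-≗ λ x → ∑²-distrib-+ (f x) (g x)) (∑-distrib-+ (λ x → ∑² (f x)) (λ x → ∑² (g x)))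

  ∑³-swap : ∀ (f : Fin n → Fin n → Fin n → ℕ) → ∑³ f ≡ ∑³ (λ x y z → f x z y)
  ∑³-swap f = sum-cong-≗ λ x → ∑-comm (f x)

  ∑³-rotate : ∀ (f : Fin n → Fin n → Fin n → ℕ) → ∑³ f ≡ ∑³ (λ x y z → f z x y)
  ∑³-rotate f = trans (∑-comm (λ x y → ∑[ z < n ] f x y z)) (sum-cong-≗ λ y → ∑-comm (λ x z → f x y z))

module _ {n : ℕ} (σ : Fin n ↔ Fin n) where
  private
    π : Fin n → Fin n
    π = Inverse.to σ

  ∑-reindex : ∀ (f : Fin n → ℕ) → ∑[ x < n ] f (π x) ≡ ∑[ x < n ] f x
  ∑-reindex f = sym (∑-permute f σ)

  ∑²-reindex : ∀ (g : Fin n → Fin n → ℕ) → ∑² (λ x y → g (π x) (π y)) ≡ ∑² g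
  ∑²-reindex g = trans (sum-cong-≗ λ x → ∑-reindex (g (π x))) (∑-reindex (λ x → ∑[ y < n ] g x y))

  ∑³-reindex : ∀ (g : Fin n → Fin n → Fin n → ℕ) → ∑³ (λ x y z → g (π x) (π y) (π z)) ≡ ∑³ g
  ∑³-reindex g =
    trans (sum-cong-≗ λ x → sum-cong-≗ λ y → ∑-reindex (g (π x) (π y))) (∑²-reindex (λ x y → ∑[ z < n ] g x y z))

-- (m − o)(n − p) = 0, stated without subtraction
m*n+o*p≡n*o+m*p⇒m≡o⊎n≡p : ∀ m n o p → m * n + o * p ≡ n * o + m * p → m ≡ o ⊎ n ≡ p
m*n+o*p≡n*o+m*p⇒m≡o⊎n≡p zero    n zero    p _  = inj₁ refl
m*n+o*p≡n*o+m*p⇒m≡o⊎n≡p zero    n (suc o) p eq =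
  inj₂ (sym (*-cancelˡ-≡ p n (suc o) (trans eq (trans (+-identityʳ (n * suc o)) (*-comm n (suc o))))))
m*n+o*p≡n*o+m*p⇒m≡o⊎n≡p (suc m) n zero    p eq =
  inj₂ (*-cancelˡ-≡ n p (suc m) (trans (sym (+-identityʳ _)) (trans eq (cong (_+ suc m * p) (*-zeroʳ n)))))
m*n+o*p≡n*o+m*p⇒m≡o⊎n≡p (suc m) n (suc o) p eq =
  map₁ (cong suc) (m*n+o*p≡n*o+m*p⇒m≡o⊎n≡p m n o p (+-cancelʳ-≡ (n + p) _ _ (trans (peel m n o p) (trans eq (sym (peel′ m n o p))))))
  where
  peel : ∀ m n o p → m * n + o * p + (n + p) ≡ suc m * n + suc o * p
  peel = solve-∀
  peel′ : ∀ m n o p → n * o + m * p + (n + p) ≡ n * suc o + suc m * p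
  peel′ = solve-∀

-- Counting subsets of Fin n

count : ∀ {n} → (Fin n → Bool) → ℕ
count {n} A = ∑[ z < n ] toℕ (A z)

toℕ-∧ : ∀ a b → toℕ (a ∧ b) ≡ toℕ a * toℕ b
toℕ-∧ true  b = sym (+-identityʳ (toℕ b))
toℕ-∧ false b = refl

toℕ-split : ∀ a b → toℕ a ≡ toℕ (a ∧ not b) + toℕ (a ∧ b)
toℕ-split true  true  = refl
toℕ-split true  false = refl
toℕ-split false b     = refl

count-∧-comm : ∀ {n} (A B : Fin n → Bool) → count (λ z → A z ∧ B z) ≡ count (λ z → B z ∧ A z)
count-∧-comm A B = sum-cong-≗ λ z → cong toℕ (∧-comm (A z) (B z))

count-pos : ∀ {n} {A : Fin n → Bool} {x} → A x ≡ true → 0 < count A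
count-pos {n} {A} {x} Ax =
  subst (_< count A) (∑-zero {n} λ _ → refl) (∑-mono-< (λ _ → z≤n) x (subst (λ b → 0 < toℕ b) (sym Ax) (s≤s z≤n)))

count-pos⇒∃ : ∀ {n} (A : Fin n → Bool) → 0 < count A → ∃ λ x → A x ≡ true
count-pos⇒∃ {suc n} A 0<∑ with A zero in A0
... | true  = zero , A0
... | false with count-pos⇒∃ (A ∘ suc) 0<∑
...   | x , Ax = suc x , Ax

count≤1⇒unique : ∀ {n} {A : Fin n → Bool} {x w} → count A ≤ 1 → A x ≡ true → A w ≡ true → w ≡ x
count≤1⇒unique {n} {A} {x} {w} ∑≤1 Ax Aw with w ≟ x
... | yes w≡x = w≡x
... | no  w≢x = ⊥-elim (<-irrefl refl (≤-trans 2≤∑ ∑≤1))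
  where
  δ+δ≤A : ∀ t → δ t x + δ t w ≤ toℕ (A t)
  δ+δ≤A t with t ≟ x | t ≟ w
  ... | yes refl | yes refl = ⊥-elim (w≢x refl)
  ... | yes refl | no  _    = subst (λ b → 1 ≤ toℕ b) (sym Ax) ≤-refl
  ... | no  _    | yes refl = subst (λ b → 1 ≤ toℕ b) (sym Aw) ≤-refl
  ... | no  _    | no  _    = z≤n
  2≤∑ : 2 ≤ count A
  2≤∑ = subst (_≤ count A) (trans (∑-distrib-+ (λ t → δ t x) (λ t → δ t w)) (cong₂ _+_ (∑-δ₁ x) (∑-δ₁ w)))
              (∑-mono-≤ δ+δ≤A)

⊆-singleton⇒count≤1 : ∀ {n} {A : Fin n → Bool} {y} → (∀ t → A t ≡ true → t ≡ y) → count A ≤ 1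
⊆-singleton⇒count≤1 {n} {A} {y} A⊆y = subst (count A ≤_) (∑-δ₁ y) (∑-mono-≤ A≤δ)
  where
  A≤δ : ∀ t → toℕ (A t) ≤ δ t y
  A≤δ t with A t in At
  ... | false = z≤n
  ... | true rewrite A⊆y t At | δ-refl y = ≤-refl

module _ {n : ℕ} where

  _─_ : (A C : Fin n → Bool) → Fin n → Bool
  (A ─ C) z = A z ∧ not (C z)

  ─-intro : ∀ (A C : Fin n → Bool) {z} → A z ≡ true → C z ≡ false → (A ─ C) z ≡ true
  ─-intro A C Az Cz rewrite Az | Cz = refl

  ─-elim : ∀ (A C : Fin n → Bool) {z} → (A ─ C) z ≡ true → A z ≡ true × C z ≡ false
  ─-elim A C {z} A─Cz with A z | C z
  ─-elim A C _  | true  | false = refl , refl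
  ─-elim A C () | true  | true
  ─-elim A C () | false | _

  separated : ∀ {A : Fin n → Bool} {y z} → A y ≡ false → A z ≡ true → y ≢ z
  separated Ay Az refl with () ← trans (sym Ay) Az

  count≡⇒count-─≡ : ∀ {A C : Fin n → Bool} → count A ≡ count C → count (A ─ C) ≡ count (C ─ A)
  count≡⇒count-─≡ {A} {C} |A|≡|C| = +-cancelʳ-≡ (count (λ z → A z ∧ C z)) _ _ (begin
    count (A ─ C) + count (λ z → A z ∧ C z)   ≡⟨ split A C ⟩
    count A                                   ≡⟨ |A|≡|C| ⟩
    count C                                   ≡⟨ sym (split C A) ⟩
    count (C ─ A) + count (λ z → C z ∧ A z)   ≡⟨ cong (count (C ─ A) +_) (count-∧-comm C A) ⟩
    count (C ─ A) + count (λ z → A z ∧ C z)   ∎)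
    where
    open ≡-Reasoning
    split : ∀ A C → count (A ─ C) + count (λ z → A z ∧ C z) ≡ count A
    split A C = trans (sym (∑-distrib-+ (λ z → toℕ ((A ─ C) z)) (λ z → toℕ (A z ∧ C z))))
                      (sum-cong-≗ λ z → sym (toℕ-split (A z) (C z)))

-- Perfect matchings on four vertices

record Distinct {n} (a b c d : Fin n) : Set where
  field
    a≢b : a ≢ b
    a≢c : a ≢ c
    a≢d : a ≢ d
    b≢c : b ≢ c
    b≢d : b ≢ d
    c≢d : c ≢ d

data Matched {n} (a b c d : Fin n) : Fin n → Fin n → Set where
  ab : Matched a b c d a b
  ba : Matched a b c d b a
  cd : Matched a b c d c d
  dc : Matched a b c d d c

module _ {n : ℕ} where

  matching : (a b c d x y : Fin n) → ℕ
  matching a b c d x y = δ x a * δ y b + δ x b * δ y a + (δ x c * δ y d + δ x d * δ y c)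

  matching-sym : ∀ a b c d x y → matching a b c d x y ≡ matching a b c d y x
  matching-sym a b c d x y = lemma (δ x a) (δ y b) (δ x b) (δ y a) (δ x c) (δ y d) (δ x d) (δ y c)
    where
    lemma : ∀ xa yb xb ya xc yd xd yc →
            xa * yb + xb * ya + (xc * yd + xd * yc) ≡ ya * xb + yb * xa + (yc * xd + yd * xc)
    lemma = solve-∀

  ∑-matching-row : ∀ a b c d x → ∑[ y < n ] matching a b c d x y ≡ δ x a + δ x b + (δ x c + δ x d)
  ∑-matching-row a b c d x = begin
    ∑[ y < n ] matching a b c d x y
      ≡⟨ ∑-distrib₄ (λ y → δ x a * δ y b) (λ y → δ x b * δ y a) (λ y → δ x c * δ y d) (λ y → δ x d * δ y c) ⟩
    ∑[ y < n ] (δ x a * δ y b) + ∑[ y < n ] (δ x b * δ y a) + (∑[ y < n ] (δ x c * δ y d) + ∑[ y < n ] (δ x d * δ y c))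
      ≡⟨ cong₂ _+_ (cong₂ _+_ (row a b) (row b a)) (cong₂ _+_ (row c d) (row d c)) ⟩
    δ x a + δ x b + (δ x c + δ x d) ∎
    where
    open ≡-Reasoning
    row : ∀ u v → ∑[ y < n ] (δ x u * δ y v) ≡ δ x u
    row u v = begin
      ∑[ y < n ] (δ x u * δ y v)  ≡⟨ sym (*-distribˡ-sum (δ x u) (λ y → δ y v)) ⟩
      δ x u * ∑[ y < n ] δ y v    ≡⟨ cong (δ x u *_) (∑-δ₁ v) ⟩
      δ x u * 1                   ≡⟨ *-identityʳ _ ⟩
      δ x u                       ∎

  ∑²-matching : ∀ a b c d (h : Fin n → Fin n → ℕ) →
                ∑² (λ x y → matching a b c d x y * h x y) ≡ h a b + h b a + (h c d + h d c)
  ∑²-matching a b c d h = begin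
    ∑² (λ x y → matching a b c d x y * h x y)
      ≡⟨ ∑²-cong (λ x y → expand (δ x a) (δ y b) (δ x b) (δ y a) (δ x c) (δ y d) (δ x d) (δ y c) (h x y)) ⟩
    ∑² (λ x y → pair a b x y + pair b a x y + (pair c d x y + pair d c x y))
      ≡⟨ trans (∑²-distrib-+ (λ x y → pair a b x y + pair b a x y) (λ x y → pair c d x y + pair d c x y))
               (cong₂ _+_ (∑²-distrib-+ (pair a b) (pair b a)) (∑²-distrib-+ (pair c d) (pair d c))) ⟩
    ∑² (pair a b) + ∑² (pair b a) + (∑² (pair c d) + ∑² (pair d c))
      ≡⟨ cong₂ _+_ (cong₂ _+_ (∑²-pair a b) (∑²-pair b a)) (cong₂ _+_ (∑²-pair c d) (∑²-pair d c)) ⟩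
    h a b + h b a + (h c d + h d c) ∎
    where
    open ≡-Reasoning
    expand : ∀ xa yb xb ya xc yd xd yc g →
             (xa * yb + xb * ya + (xc * yd + xd * yc)) * g ≡ xa * (yb * g) + xb * (ya * g) + (xc * (yd * g) + xd * (yc * g))
    expand = solve-∀
    pair : Fin n → Fin n → Fin n → Fin n → ℕ
    pair u v x y = δ x u * (δ y v * h x y)
    ∑²-pair : ∀ u v → ∑² (pair u v) ≡ h u v
    ∑²-pair u v = begin
      ∑[ x < n ] ∑[ y < n ] (δ x u * (δ y v * h x y))
        ≡⟨ sum-cong-≗ (λ x → sym (*-distribˡ-sum (δ x u) (λ y → δ y v * h x y))) ⟩
      ∑[ x < n ] (δ x u * ∑[ y < n ] (δ y v * h x y))
        ≡⟨ sum-cong-≗ (λ x → cong (δ x u *_) (∑-δ v (h x))) ⟩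
      ∑[ x < n ] (δ x u * h x v)
        ≡⟨ ∑-δ u (λ x → h x v) ⟩
      h u v ∎

  ∑²-+-matching : ∀ a b c d {M F : Fin n → Fin n → ℕ} → (∀ x y → F x y ≡ M x y + matching a b c d x y) →
                  ∀ (h : Fin n → Fin n → ℕ) →
                  ∑² (λ x y → F x y * h x y) ≡ ∑² (λ x y → M x y * h x y) + (h a b + h b a + (h c d + h d c))
  ∑²-+-matching a b c d {M} {F} F≡M+D h = begin
    ∑² (λ x y → F x y * h x y)
      ≡⟨ ∑²-cong (λ x y → trans (cong (_* h x y) (F≡M+D x y)) (*-distribʳ-+ (h x y) (M x y) (matching a b c d x y))) ⟩
    ∑² (λ x y → M x y * h x y + matching a b c d x y * h x y)
      ≡⟨ ∑²-distrib-+ (λ x y → M x y * h x y) (λ x y → matching a b c d x y * h x y) ⟩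
    ∑² (λ x y → M x y * h x y) + ∑² (λ x y → matching a b c d x y * h x y)
      ≡⟨ cong (∑² (λ x y → M x y * h x y) +_) (∑²-matching a b c d h) ⟩
    ∑² (λ x y → M x y * h x y) + (h a b + h b a + (h c d + h d c)) ∎
    where open ≡-Reasoning

  δ*δ-support : ∀ (x a y b : Fin n) → δ x a * δ y b ≡ 0 ⊎ (x ≡ a × y ≡ b)
  δ*δ-support x a y b with x ≟ a | y ≟ b
  ... | yes x≡a | yes y≡b = inj₂ (x≡a , y≡b)
  ... | yes _   | no  _   = inj₁ refl
  ... | no  _   | _       = inj₁ refl

  matching-support : ∀ a b c d x y → matching a b c d x y ≡ 0 ⊎ Matched a b c d x y
  matching-support a b c d x y
    with δ*δ-support x a y b | δ*δ-support x b y a | δ*δ-support x c y d | δ*δ-support x d y c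
  ... | inj₂ (refl , refl) | _                  | _                  | _                  = inj₂ ab
  ... | inj₁ _             | inj₂ (refl , refl) | _                  | _                  = inj₂ ba
  ... | inj₁ _             | inj₁ _             | inj₂ (refl , refl) | _                  = inj₂ cd
  ... | inj₁ _             | inj₁ _             | inj₁ _             | inj₂ (refl , refl) = inj₂ dc
  ... | inj₁ ab≡0          | inj₁ ba≡0          | inj₁ cd≡0          | inj₁ dc≡0          =
    inj₁ (cong₂ _+_ (cong₂ _+_ ab≡0 ba≡0) (cong₂ _+_ cd≡0 dc≡0))

  matching-≢ : ∀ {a b c d x y : Fin n} → y ≢ a → y ≢ b → y ≢ c → y ≢ d → matching a b c d x y ≡ 0
  matching-≢ {a} {b} {c} {d} {x} {y} y≢a y≢b y≢c y≢d with matching-support a b c d x y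
  ... | inj₁ m≡0 = m≡0
  ... | inj₂ ab  = ⊥-elim (y≢b refl)
  ... | inj₂ ba  = ⊥-elim (y≢a refl)
  ... | inj₂ cd  = ⊥-elim (y≢d refl)
  ... | inj₂ dc  = ⊥-elim (y≢c refl)

  module _ {a b c d : Fin n} (distinct : Distinct a b c d) where
    open Distinct distinct

    matched-irrefl : ∀ {x} → Matched a b c d x x → ⊥
    matched-irrefl ab = a≢b refl
    matched-irrefl ba = a≢b refl
    matched-irrefl cd = c≢d refl
    matched-irrefl dc = c≢d refl

    matched-functional : ∀ {v x y} → Matched a b c d v x → Matched a b c d v y → x ≡ y
    matched-functional ab ab = refl
    matched-functional ba ba = refl
    matched-functional cd cd = refl
    matched-functional dc dc = refl
    matched-functional ab ba = ⊥-elim (a≢b refl)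
    matched-functional ab cd = ⊥-elim (a≢c refl)
    matched-functional ab dc = ⊥-elim (a≢d refl)
    matched-functional ba ab = ⊥-elim (a≢b refl)
    matched-functional ba cd = ⊥-elim (b≢c refl)
    matched-functional ba dc = ⊥-elim (b≢d refl)
    matched-functional cd ab = ⊥-elim (a≢c refl)
    matched-functional cd ba = ⊥-elim (b≢c refl)
    matched-functional cd dc = ⊥-elim (c≢d refl)
    matched-functional dc ab = ⊥-elim (a≢d refl)
    matched-functional dc ba = ⊥-elim (b≢d refl)
    matched-functional dc cd = ⊥-elim (c≢d refl)

    matching-irrefl : ∀ x → matching a b c d x x ≡ 0
    matching-irrefl x with matching-support a b c d x x
    ... | inj₁ m≡0 = m≡0
    ... | inj₂ m   = ⊥-elim (matched-irrefl m)

    matching-shared : ∀ v x y → matching a b c d v x * matching a b c d v y ≡ 0 ⊎ x ≡ y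
    matching-shared v x y with matching-support a b c d v x | matching-support a b c d v y
    ... | inj₁ m≡0 | _        = inj₁ (cong (_* matching a b c d v y) m≡0)
    ... | inj₂ _   | inj₁ m≡0 = inj₁ (trans (cong (matching a b c d v x *_) m≡0) (*-zeroʳ (matching a b c d v x)))
    ... | inj₂ m   | inj₂ m′  = inj₂ (matched-functional m m′)

-- Triangles

module _ {n : ℕ} where

  degree : (Fin n → Fin n → ℕ) → Fin n → ℕ
  degree A x = ∑[ y < n ] A x y

  codegree : (Fin n → Fin n → ℕ) → Fin n → Fin n → ℕ
  codegree A x y = ∑[ z < n ] (A x z * A y z)

  triangles : (Fin n → Fin n → ℕ) → ℕ
  triangles A = ∑³ λ x y z → A x y * (A x z * A y z)

  triangles-reindex : ∀ (σ : Fin n ↔ Fin n) (A : Fin n → Fin n → ℕ) →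
                      triangles (λ x y → A (Inverse.to σ x) (Inverse.to σ y)) ≡ triangles A
  triangles-reindex σ A = ∑³-reindex σ λ x y z → A x y * (A x z * A y z)

  module _ (M : Fin n → Fin n → ℕ) (M-sym : ∀ x y → M x y ≡ M y x) (M-irrefl : ∀ x → M x x ≡ 0)
           {a b c d : Fin n} (distinct : Distinct a b c d) where

    private
      D : Fin n → Fin n → ℕ
      D = matching a b c d

      codegree-sym : ∀ x y → codegree M x y ≡ codegree M y x
      codegree-sym x y = sum-cong-≗ λ z → *-comm (M x z) (M y z)

      triangles-through-matching : ∑³ (λ x y z → D x y * (M x z * M y z)) ≡ 2 * (codegree M a b + codegree M c d)
      triangles-through-matching = begin
        ∑³ (λ x y z → D x y * (M x z * M y z))
          ≡⟨ ∑²-cong (λ x y → sym (*-distribˡ-sum (D x y) (λ z → M x z * M y z))) ⟩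
        ∑² (λ x y → D x y * codegree M x y)
          ≡⟨ ∑²-matching a b c d (codegree M) ⟩
        codegree M a b + codegree M b a + (codegree M c d + codegree M d c)
          ≡⟨ cong₂ (λ k l → codegree M a b + k + (codegree M c d + l)) (codegree-sym b a) (codegree-sym d c) ⟩
        codegree M a b + codegree M a b + (codegree M c d + codegree M c d)
          ≡⟨ double (codegree M a b) (codegree M c d) ⟩
        2 * (codegree M a b + codegree M c d) ∎
        where
        open ≡-Reasoning
        double : ∀ u v → u + u + (v + v) ≡ 2 * (u + v)
        double = solve-∀

      vanish : ∀ (G : Fin n → Fin n → ℕ) → (∀ x → G x x ≡ 0) → ∀ v x y → D v x * D v y * G x y ≡ 0
      vanish G G-irrefl v x y with matching-shared distinct v x y
      ... | inj₁ DD≡0 = cong (_* G x y) DD≡0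
      ... | inj₂ refl = trans (cong (D v x * D v x *_) (G-irrefl x)) (*-zeroʳ (D v x * D v x))

    triangles-+-matching : ∀ (F : Fin n → Fin n → ℕ) → (∀ x y → F x y ≡ M x y + D x y) →
                           triangles F ≡ triangles M + 6 * (codegree M a b + codegree M c d)
    triangles-+-matching F F≡M+D = begin
      triangles F
        ≡⟨ ∑³-cong expand ⟩
      ∑³ (λ x y z → M x y * (M x z * M y z) + (T₁ x y z + T₂ x y z + T₃ x y z))
        ≡⟨ trans (∑³-distrib-+ (λ x y z → M x y * (M x z * M y z)) (λ x y z → T₁ x y z + T₂ x y z + T₃ x y z))
                 (cong (triangles M +_) (trans (∑³-distrib-+ (λ x y z → T₁ x y z + T₂ x y z) T₃)
                                               (cong (_+ ∑³ T₃) (∑³-distrib-+ T₁ T₂)))) ⟩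
      triangles M + (∑³ T₁ + ∑³ T₂ + ∑³ T₃)
        ≡⟨ cong₂ (λ k l → triangles M + (∑³ T₁ + k + l))
                 (trans (∑³-swap T₂) (∑³-cong T₂≡T₁)) (trans (∑³-rotate T₃) (∑³-cong T₃≡T₁)) ⟩
      triangles M + (∑³ T₁ + ∑³ T₁ + ∑³ T₁)
        ≡⟨ cong (λ k → triangles M + (k + k + k)) triangles-through-matching ⟩
      triangles M + (2 * C + 2 * C + 2 * C)
        ≡⟨ cong (triangles M +_) (sextuple C) ⟩
      triangles M + 6 * C ∎
      where
      open ≡-Reasoning
      C = codegree M a b + codegree M c d
      sextuple : ∀ u → 2 * u + 2 * u + 2 * u ≡ 6 * u
      sextuple = solve-∀
      T₁ T₂ T₃ : Fin n → Fin n → Fin n → ℕ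
      T₁ x y z = D x y * (M x z * M y z)
      T₂ x y z = M x y * (D x z * M y z)
      T₃ x y z = M x y * (M x z * D y z)
      T₂≡T₁ : ∀ x y z → T₂ x z y ≡ T₁ x y z
      T₂≡T₁ x y z = trans (cong (λ k → M x z * (D x y * k)) (M-sym z y)) (swap (M x z) (D x y) (M y z))
        where
        swap : ∀ u v w → u * (v * w) ≡ v * (u * w)
        swap = solve-∀
      T₃≡T₁ : ∀ x y z → T₃ z x y ≡ T₁ x y z
      T₃≡T₁ x y z = trans (cong₂ (λ k l → k * (l * D x y)) (M-sym z x) (M-sym z y)) (rotate (M x z) (M y z) (D x y))
        where
        rotate : ∀ u v w → u * (v * w) ≡ w * (u * v)
        rotate = solve-∀
      expand : ∀ x y z → F x y * (F x z * F y z) ≡ M x y * (M x z * M y z) + (T₁ x y z + T₂ x y z + T₃ x y z)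
      expand x y z = begin
        F x y * (F x z * F y z)
          ≡⟨ cong₂ _*_ (F≡M+D x y) (cong₂ _*_ (F≡M+D x z) (F≡M+D y z)) ⟩
        (M x y + D x y) * ((M x z + D x z) * (M y z + D y z))
          ≡⟨ ring (M x y) (M x z) (M y z) (D x y) (D x z) (D y z) ⟩
        M x y * (M x z * M y z) + (T₁ x y z + T₂ x y z + T₃ x y z)
          + (D x y * D x z * (M y z + D y z) + D x y * D y z * M x z + D x z * D y z * M x y)
          ≡⟨ cong (M x y * (M x z * M y z) + (T₁ x y z + T₂ x y z + T₃ x y z) +_) (cong₂ _+_ (cong₂ _+_ V₁ V₂) V₃) ⟩
        M x y * (M x z * M y z) + (T₁ x y z + T₂ x y z + T₃ x y z) + 0
          ≡⟨ +-identityʳ _ ⟩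
        M x y * (M x z * M y z) + (T₁ x y z + T₂ x y z + T₃ x y z) ∎
        where
        ring : ∀ m₁ m₂ m₃ d₁ d₂ d₃ → (m₁ + d₁) * ((m₂ + d₂) * (m₃ + d₃)) ≡
               m₁ * (m₂ * m₃) + (d₁ * (m₂ * m₃) + m₁ * (d₂ * m₃) + m₁ * (m₂ * d₃))
               + (d₁ * d₂ * (m₃ + d₃) + d₁ * d₃ * m₂ + d₂ * d₃ * m₁)
        ring = solve-∀
        V₁ : D x y * D x z * (M y z + D y z) ≡ 0
        V₁ = vanish (λ u v → M u v + D u v) (λ u → cong₂ _+_ (M-irrefl u) (matching-irrefl distinct u)) x y z
        V₂ : D x y * D y z * M x z ≡ 0
        V₂ = trans (cong (λ k → k * D y z * M x z) (matching-sym a b c d x y)) (vanish M M-irrefl y x z)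
        V₃ : D x z * D y z * M x y ≡ 0
        V₃ = trans (cong₂ (λ k l → k * l * M x y) (matching-sym a b c d x z) (matching-sym a b c d y z)) (vanish M M-irrefl z x y)

-- Four subsets with balanced pairwise intersections

module _ {n : ℕ} where

  record _∩_∖_∪_ (A B C D : Fin n → Bool) (z : Fin n) : Set where
    constructor in-out
    field
      ∈₁ : A z ≡ true
      ∈₂ : B z ≡ true
      ∉₁ : C z ≡ false
      ∉₂ : D z ≡ false

  ∩-comm : ∀ {A B C D z} → (A ∩ B ∖ C ∪ D) z → (B ∩ A ∖ C ∪ D) z
  ∩-comm (in-out Az Bz Cz Dz) = in-out Bz Az Cz Dz

  ∪-comm : ∀ {A B C D z} → (A ∩ B ∖ C ∪ D) z → (A ∩ B ∖ D ∪ C) z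
  ∪-comm (in-out Az Bz Cz Dz) = in-out Az Bz Dz Cz

  -- A, B, C, D are read around a 4-cycle: A ∩ B and C ∩ D are the parallel intersections, B ∩ C and A ∩ D the crossing ones
  record TriangleBalance (A B C D : Fin n → Bool) : Set where
    constructor balanced
    field
      counts : count (λ z → A z ∧ B z) + count (λ z → C z ∧ D z) ≡ count (λ z → B z ∧ C z) + count (λ z → A z ∧ D z)

  TriangleBalance-reflect : ∀ {A B C D} → TriangleBalance A B C D → TriangleBalance C B A D
  TriangleBalance-reflect {A} {B} {C} {D} (balanced balance) = balanced (begin
    count (λ z → C z ∧ B z) + count (λ z → A z ∧ D z)  ≡⟨ cong (_+ count (λ z → A z ∧ D z)) (count-∧-comm C B) ⟩
    count (λ z → B z ∧ C z) + count (λ z → A z ∧ D z)  ≡⟨ sym balance ⟩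
    count (λ z → A z ∧ B z) + count (λ z → C z ∧ D z)  ≡⟨ cong (_+ count (λ z → C z ∧ D z)) (count-∧-comm A B) ⟩
    count (λ z → B z ∧ A z) + count (λ z → C z ∧ D z)  ∎)
    where open ≡-Reasoning

  TriangleBalance-swap : ∀ {A B C D} → TriangleBalance A B C D → TriangleBalance B A D C
  TriangleBalance-swap {A} {B} {C} {D} (balanced balance) = balanced (begin
    count (λ z → B z ∧ A z) + count (λ z → D z ∧ C z)  ≡⟨ cong₂ _+_ (count-∧-comm B A) (count-∧-comm D C) ⟩
    count (λ z → A z ∧ B z) + count (λ z → C z ∧ D z)  ≡⟨ balance ⟩
    count (λ z → B z ∧ C z) + count (λ z → A z ∧ D z)  ≡⟨ +-comm (count (λ z → B z ∧ C z)) _ ⟩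
    count (λ z → A z ∧ D z) + count (λ z → B z ∧ C z)  ∎)
    where open ≡-Reasoning

  TriangleBalance-rotate : ∀ {A B C D} → TriangleBalance A B C D → TriangleBalance B C D A
  TriangleBalance-rotate {A} {B} {C} {D} (balanced balance) = balanced (begin
    count (λ z → B z ∧ C z) + count (λ z → D z ∧ A z)  ≡⟨ cong (count (λ z → B z ∧ C z) +_) (count-∧-comm D A) ⟩
    count (λ z → B z ∧ C z) + count (λ z → A z ∧ D z)  ≡⟨ sym balance ⟩
    count (λ z → A z ∧ B z) + count (λ z → C z ∧ D z)  ≡⟨ +-comm (count (λ z → A z ∧ B z)) _ ⟩
    count (λ z → C z ∧ D z) + count (λ z → A z ∧ B z)  ≡⟨ cong (count (λ z → C z ∧ D z) +_) (count-∧-comm A B) ⟩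
    count (λ z → C z ∧ D z) + count (λ z → B z ∧ A z)  ∎)
    where open ≡-Reasoning

parallel>crossing : ∀ a b c d → toℕ (b ∧ c) + toℕ (a ∧ d) < toℕ (a ∧ b) + toℕ (c ∧ d) →
                    (a ≡ true × b ≡ true × c ≡ false × d ≡ false) ⊎ (a ≡ false × b ≡ false × c ≡ true × d ≡ true)
parallel>crossing true  true  false false _ = inj₁ (refl , refl , refl , refl)
parallel>crossing false false true  true  _ = inj₂ (refl , refl , refl , refl)
parallel>crossing true  true  true  true  (s≤s (s≤s ()))
parallel>crossing true  true  true  false (s≤s ())
parallel>crossing true  true  false true  (s≤s ())
parallel>crossing true  false true  true  (s≤s ())
parallel>crossing false true  true  true  (s≤s ())
parallel>crossing true  false true  false ()
parallel>crossing true  false false true  ()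
parallel>crossing true  false false false ()
parallel>crossing false true  true  false ()
parallel>crossing false true  false true  ()
parallel>crossing false true  false false ()
parallel>crossing false false true  false ()
parallel>crossing false false false true  ()
parallel>crossing false false false false ()

data BalancedDifference {n} (A B C D : Fin n → Bool) (x y : Fin n) : Set where
  another : ∀ t → (C ─ A) t ≡ true → t ≢ y → BalancedDifference A B C D x y
  exact   : (A ∩ B ∖ C ∪ D) x → (B ∩ C ∖ A ∪ D) y → BalancedDifference A B C D x y

module _ {n : ℕ} {A B C D : Fin n → Bool} (balance : TriangleBalance A B C D) where

  private
    parallel crossing : Fin n → ℕ
    parallel z = toℕ (A z ∧ B z) + toℕ (C z ∧ D z)
    crossing z = toℕ (B z ∧ C z) + toℕ (A z ∧ D z)

    ∑parallel≡∑crossing : ∑[ z < n ] parallel z ≡ ∑[ z < n ] crossing z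
    ∑parallel≡∑crossing =
      trans (∑-distrib-+ (λ z → toℕ (A z ∧ B z)) (λ z → toℕ (C z ∧ D z)))
            (trans (TriangleBalance.counts balance) (sym (∑-distrib-+ (λ z → toℕ (B z ∧ C z)) (λ z → toℕ (A z ∧ D z)))))

    parallel-profile : ∀ {z} → crossing z < parallel z → (A ∩ B ∖ C ∪ D) z ⊎ (C ∩ D ∖ A ∪ B) z
    parallel-profile {z} crossing<parallel with parallel>crossing (A z) (B z) (C z) (D z) crossing<parallel
    ... | inj₁ (Az , Bz , Cz , Dz) = inj₁ (in-out Az Bz Cz Dz)
    ... | inj₂ (Az , Bz , Cz , Dz) = inj₂ (in-out Cz Dz Az Bz)

  crossing⇒parallel : ∀ {w} → (B ∩ C ∖ A ∪ D) w → ∃ λ z → (A ∩ B ∖ C ∪ D) z ⊎ (C ∩ D ∖ A ∪ B) z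
  crossing⇒parallel {w} (in-out Bw Cw Aw Dw) = map₂ parallel-profile (∑≡∑∧<⇒> ∑parallel≡∑crossing w parallel<crossing)
    where
    parallel<crossing : parallel w < crossing w
    parallel<crossing rewrite Aw | Bw | Cw | Dw = s≤s z≤n

  -- If C ∖ A has no element besides y, then |A ∖ C| = |C ∖ A| makes both differences singletons;
  -- y then lies in B ∩ C only, and the balance yields a vertex in A ∩ B only, which must be x.
  balanced-difference : count A ≡ count C → ∀ {x y} → (A ─ C) x ≡ true → (B ─ D) y ≡ true → BalancedDifference A B C D x y
  balanced-difference |A|≡|C| {x} {y} x∈A─C y∈B─D with any? (λ t → ((C ─ A) t ≟ᵇ true) ×-dec ¬? (t ≟ y))
  ... | yes (t , t∈C─A , t≢y) = another t t∈C─A t≢y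
  ... | no  ∄other = exact x-profile y-profile
    where
    C─A⊆y : ∀ t → (C ─ A) t ≡ true → t ≡ y
    C─A⊆y t t∈C─A with t ≟ y
    ... | yes t≡y = t≡y
    ... | no  t≢y = ⊥-elim (∄other (t , t∈C─A , t≢y))

    |A─C|≡|C─A| : count (A ─ C) ≡ count (C ─ A)
    |A─C|≡|C─A| = count≡⇒count-─≡ {A = A} {C} |A|≡|C|

    |A─C|≤1 : count (A ─ C) ≤ 1
    |A─C|≤1 = subst (_≤ 1) (sym |A─C|≡|C─A|) (⊆-singleton⇒count≤1 {A = C ─ A} C─A⊆y)

    y∈C─A : (C ─ A) y ≡ true
    y∈C─A with count-pos⇒∃ (C ─ A) (subst (0 <_) |A─C|≡|C─A| (count-pos {A = A ─ C} x∈A─C))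
    ... | t , t∈C─A = subst (λ u → (C ─ A) u ≡ true) (C─A⊆y t t∈C─A) t∈C─A

    y-profile : (B ∩ C ∖ A ∪ D) y
    y-profile with ─-elim B D y∈B─D | ─-elim C A y∈C─A
    ... | By , Dy | Cy , Ay = in-out By Cy Ay Dy

    x-profile : (A ∩ B ∖ C ∪ D) x
    x-profile with crossing⇒parallel y-profile
    ... | z , inj₁ z-profile@(in-out Az _ Cz _) =
      subst (A ∩ B ∖ C ∪ D) (count≤1⇒unique |A─C|≤1 x∈A─C (─-intro A C Az Cz)) z-profile
    ... | z , inj₂ (in-out Cz _ Az Bz) =
      ⊥-elim (separated {A = B} Bz (proj₁ (─-elim B D y∈B─D)) (C─A⊆y z (─-intro C A Cz Az)))

-- The 2-switch on an alternating 4-cycle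

samePair?-sym : ∀ {n} (x y a b : Fin n) → samePair? x y a b ≡ samePair? y x a b
samePair?-sym x y a b =
  trans (∨-comm (⌊ x ≟ a ⌋ ∧ ⌊ y ≟ b ⌋) (⌊ x ≟ b ⌋ ∧ ⌊ y ≟ a ⌋))
        (cong₂ _∨_ (∧-comm ⌊ x ≟ b ⌋ ⌊ y ≟ a ⌋) (∧-comm ⌊ x ≟ a ⌋ ⌊ y ≟ b ⌋))

switchAdj-sym : ∀ {n} {e : Fin n → Fin n → Bool} → (∀ x y → e x y ≡ e y x) →
                ∀ a b c d x y → switchAdj e a b c d x y ≡ switchAdj e a b c d y x
switchAdj-sym e-sym a b c d x y
  rewrite samePair?-sym x y a b | samePair?-sym x y c d | samePair?-sym x y b c | samePair?-sym x y a d | e-sym x y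
  = refl

record AlternatingCycle {n} (G : Graph n) (p q r s : Fin n) : Set where
  field
    distinct : Distinct p q r s
    pq∈E : adj G p q ≡ true
    rs∈E : adj G r s ≡ true
    qr∉E : adj G q r ≡ false
    ps∉E : adj G p s ≡ false
  open Distinct distinct public
    renaming (a≢b to p≢q; a≢c to p≢r; a≢d to p≢s; b≢c to q≢r; b≢d to q≢s; c≢d to r≢s)

Outside : ∀ {n} (p q r s z : Fin n) → Set
Outside p q r s z = z ≢ p × z ≢ q × z ≢ r × z ≢ s

module Switch {n} (G : Graph n) {p q r s : Fin n} (cycle : AlternatingCycle G p q r s) where
  open AlternatingCycle cycle

  e e′ : Fin n → Fin n → Bool
  e  = adj G
  e′ = switchAdj e p q r s

  e-sym : ∀ x y → e x y ≡ e y x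
  e-sym = Graph.sym G

  E E′ M P Q : Fin n → Fin n → ℕ
  E  x y = toℕ (e x y)
  E′ x y = toℕ (e′ x y)
  M  x y = toℕ (e x y ∧ e′ x y)
  P = matching p q r s
  Q = matching q r p s

  -- indexed by the bits ⌊ x ≟ p ⌋, …, ⌊ x ≟ s ⌋, so that matching on a position makes e′ and the matchings compute
  data Position (x : Fin n) : Bool → Bool → Bool → Bool → Set where
    at-p : x ≡ p → Position x true false false false
    at-q : x ≡ q → Position x false true false false
    at-r : x ≡ r → Position x false false true false
    at-s : x ≡ s → Position x false false false true
    away : Outside p q r s x → Position x false false false false

  position : ∀ x → Position x ⌊ x ≟ p ⌋ ⌊ x ≟ q ⌋ ⌊ x ≟ r ⌋ ⌊ x ≟ s ⌋
  position x with x ≟ p | x ≟ q | x ≟ r | x ≟ s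
  ... | yes refl | yes x≡q  | _        | _        = ⊥-elim (p≢q x≡q)
  ... | yes refl | _        | yes x≡r  | _        = ⊥-elim (p≢r x≡r)
  ... | yes refl | _        | _        | yes x≡s  = ⊥-elim (p≢s x≡s)
  ... | _        | yes refl | yes x≡r  | _        = ⊥-elim (q≢r x≡r)
  ... | _        | yes refl | _        | yes x≡s  = ⊥-elim (q≢s x≡s)
  ... | _        | _        | yes refl | yes x≡s  = ⊥-elim (r≢s x≡s)
  ... | yes x≡p  | no _     | no _     | no _     = at-p x≡p
  ... | no _     | yes x≡q  | no _     | no _     = at-q x≡q
  ... | no _     | no _     | yes x≡r  | no _     = at-r x≡r
  ... | no _     | no _     | no _     | yes x≡s  = at-s x≡s
  ... | no x≢p   | no x≢q   | no x≢r   | no x≢s   = away (x≢p , x≢q , x≢r , x≢s)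

  -- e′ x y and matching a b c d x y as functions of the bits of x and y
  switchᵇ : (xp xq xr xs yp yq yr ys b : Bool) → Bool
  switchᵇ xp xq xr xs yp yq yr ys b =
    if (xp ∧ yq ∨ xq ∧ yp) ∨ (xr ∧ ys ∨ xs ∧ yr) then false
    else if (xq ∧ yr ∨ xr ∧ yq) ∨ (xp ∧ ys ∨ xs ∧ yp) then true
    else b

  matchingᵇ : (xa xb xc xd ya yb yc yd : Bool) → ℕ
  matchingᵇ xa xb xc xd ya yb yc yd = toℕ xa * toℕ yb + toℕ xb * toℕ ya + (toℕ xc * toℕ yd + toℕ xd * toℕ yc)

  data Change (b b′ : Bool) (m m′ : ℕ) : Set where
    removed : b ≡ true  → b′ ≡ false → m ≡ 1 → m′ ≡ 0 → Change b b′ m m′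
    added   : b ≡ false → b′ ≡ true  → m ≡ 0 → m′ ≡ 1 → Change b b′ m m′
    kept    : b′ ≡ b → m ≡ 0 → m′ ≡ 0 → Change b b′ m m′

  change : ∀ {x y xp xq xr xs yp yq yr ys} → Position x xp xq xr xs → Position y yp yq yr ys →
           Change (e x y) (switchᵇ xp xq xr xs yp yq yr ys (e x y))
                  (matchingᵇ xp xq xr xs yp yq yr ys) (matchingᵇ xq xr xp xs yq yr yp ys)
  change (away _)    _           = kept refl refl refl
  change (at-p _)    (away _)    = kept refl refl refl
  change (at-q _)    (away _)    = kept refl refl refl
  change (at-r _)    (away _)    = kept refl refl refl
  change (at-s _)    (away _)    = kept refl refl refl
  change (at-p refl) (at-p refl) = kept refl refl refl
  change (at-p refl) (at-q refl) = removed pq∈E refl refl refl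
  change (at-p refl) (at-r refl) = kept refl refl refl
  change (at-p refl) (at-s refl) = added ps∉E refl refl refl
  change (at-q refl) (at-p refl) = removed (trans (e-sym q p) pq∈E) refl refl refl
  change (at-q refl) (at-q refl) = kept refl refl refl
  change (at-q refl) (at-r refl) = added qr∉E refl refl refl
  change (at-q refl) (at-s refl) = kept refl refl refl
  change (at-r refl) (at-p refl) = kept refl refl refl
  change (at-r refl) (at-q refl) = added (trans (e-sym r q) qr∉E) refl refl refl
  change (at-r refl) (at-r refl) = kept refl refl refl
  change (at-r refl) (at-s refl) = removed rs∈E refl refl refl
  change (at-s refl) (at-p refl) = added (trans (e-sym s p) ps∉E) refl refl refl
  change (at-s refl) (at-q refl) = kept refl refl refl
  change (at-s refl) (at-r refl) = removed (trans (e-sym s r) rs∈E) refl refl refl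
  change (at-s refl) (at-s refl) = kept refl refl refl

  classify : ∀ x y → Change (e x y) (e′ x y) (P x y) (Q x y)
  classify x y = change (position x) (position y)

  private
    change-decomposition : ∀ {b b′ m m′} → Change b b′ m m′ →
                           (toℕ b ≡ toℕ (b ∧ b′) + m) × (toℕ b′ ≡ toℕ (b ∧ b′) + m′)
    change-decomposition (removed refl refl refl refl) = refl , refl
    change-decomposition (added refl refl refl refl)   = refl , refl
    change-decomposition {b} (kept refl refl refl)     = unchanged , unchanged
      where
      unchanged : toℕ b ≡ toℕ (b ∧ b) + 0
      unchanged = trans (cong toℕ (sym (∧-idem b))) (sym (+-identityʳ _))

  E≡M+P : ∀ x y → E x y ≡ M x y + P x y
  E≡M+P x y = proj₁ (change-decomposition (classify x y))

  E′≡M+Q : ∀ x y → E′ x y ≡ M x y + Q x y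
  E′≡M+Q x y = proj₂ (change-decomposition (classify x y))

  M-sym : ∀ x y → M x y ≡ M y x
  M-sym x y = cong toℕ (cong₂ _∧_ (e-sym x y) (switchAdj-sym e-sym p q r s x y))

  M-irrefl : ∀ x → M x x ≡ 0
  M-irrefl x = cong (λ b → toℕ (b ∧ e′ x x)) (irrefl G x)

  outside : Fin n → Bool
  outside z = not (⌊ z ≟ p ⌋ ∨ ⌊ z ≟ q ⌋ ∨ ⌊ z ≟ r ⌋ ∨ ⌊ z ≟ s ⌋)

  private
    partitionᵇ : ∀ {z zp zq zr zs} → Position z zp zq zr zs →
                 toℕ zp + toℕ zq + (toℕ zr + toℕ zs) + toℕ (not (zp ∨ zq ∨ zr ∨ zs)) ≡ 1
    partitionᵇ (at-p _) = refl
    partitionᵇ (at-q _) = refl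
    partitionᵇ (at-r _) = refl
    partitionᵇ (at-s _) = refl
    partitionᵇ (away _) = refl

    outside-soundᵇ : ∀ {z zp zq zr zs} → Position z zp zq zr zs → not (zp ∨ zq ∨ zr ∨ zs) ≡ true → Outside p q r s z
    outside-soundᵇ (away z-out) _ = z-out

    outside-completeᵇ : ∀ {z zp zq zr zs} → Position z zp zq zr zs → Outside p q r s z → not (zp ∨ zq ∨ zr ∨ zs) ≡ true
    outside-completeᵇ (at-p z≡p) (z≢p , _)         = ⊥-elim (z≢p z≡p)
    outside-completeᵇ (at-q z≡q) (_ , z≢q , _)     = ⊥-elim (z≢q z≡q)
    outside-completeᵇ (at-r z≡r) (_ , _ , z≢r , _) = ⊥-elim (z≢r z≡r)
    outside-completeᵇ (at-s z≡s) (_ , _ , _ , z≢s) = ⊥-elim (z≢s z≡s)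
    outside-completeᵇ (away _)   _                 = refl

  partition : ∀ z → δ z p + δ z q + (δ z r + δ z s) + toℕ (outside z) ≡ 1
  partition z = partitionᵇ (position z)

  outside-sound : ∀ {z} → outside z ≡ true → Outside p q r s z
  outside-sound {z} = outside-soundᵇ (position z)

  outside-complete : ∀ {z} → Outside p q r s z → outside z ≡ true
  outside-complete {z} = outside-completeᵇ (position z)

  ∑-split : ∀ (f : Fin n → ℕ) → ∑[ z < n ] f z ≡ f p + f q + (f r + f s) + ∑[ z < n ] (toℕ (outside z) * f z)
  ∑-split f = begin
    ∑[ z < n ] f z
      ≡⟨ sum-cong-≗ (λ z → trans (sym (*-identityˡ (f z))) (cong (_* f z) (sym (partition z)))) ⟩
    ∑[ z < n ] ((δ z p + δ z q + (δ z r + δ z s) + toℕ (outside z)) * f z)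
      ≡⟨ sum-cong-≗ (λ z → distrib (δ z p) (δ z q) (δ z r) (δ z s) (toℕ (outside z)) (f z)) ⟩
    ∑[ z < n ] (δ z p * f z + δ z q * f z + (δ z r * f z + δ z s * f z) + toℕ (outside z) * f z)
      ≡⟨ trans (∑-distrib-+ (λ z → δ z p * f z + δ z q * f z + (δ z r * f z + δ z s * f z)) (λ z → toℕ (outside z) * f z))
               (cong (_+ ∑[ z < n ] (toℕ (outside z) * f z))
                     (∑-distrib₄ (λ z → δ z p * f z) (λ z → δ z q * f z) (λ z → δ z r * f z) (λ z → δ z s * f z))) ⟩
    ∑[ z < n ] (δ z p * f z) + ∑[ z < n ] (δ z q * f z) + (∑[ z < n ] (δ z r * f z) + ∑[ z < n ] (δ z s * f z))
      + ∑[ z < n ] (toℕ (outside z) * f z)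
      ≡⟨ cong (_+ ∑[ z < n ] (toℕ (outside z) * f z))
              (cong₂ _+_ (cong₂ _+_ (∑-δ p f) (∑-δ q f)) (cong₂ _+_ (∑-δ r f) (∑-δ s f))) ⟩
    f p + f q + (f r + f s) + ∑[ z < n ] (toℕ (outside z) * f z) ∎
    where
    open ≡-Reasoning
    distrib : ∀ a b c d o x → (a + b + (c + d) + o) * x ≡ a * x + b * x + (c * x + d * x) + o * x
    distrib = solve-∀

  N : Fin n → Fin n → Bool
  N u z = outside z ∧ e u z

  N-outside : ∀ {u z} → Outside p q r s z → N u z ≡ e u z
  N-outside {u} {z} z-out = cong (_∧ e u z) (outside-complete z-out)

  private
    e′pq≡false : e′ p q ≡ false
    e′pq≡false rewrite ≟-refl p | ≟-refl q = refl

    e′rs≡false : e′ r s ≡ false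
    e′rs≡false rewrite ≟-refl r | ≟-refl s | ∨-zeroʳ (samePair? r s p q) = refl

    M-non-edge : ∀ {x y} → e x y ≡ false → M x y ≡ 0
    M-non-edge {x} {y} exy = cong (λ b → toℕ (b ∧ e′ x y)) exy

    M-removed : ∀ {x y} → e′ x y ≡ false → M x y ≡ 0
    M-removed {x} {y} e′xy = trans (cong (λ b → toℕ (e x y ∧ b)) e′xy) (cong toℕ (∧-zeroʳ (e x y)))

    M-outside : ∀ {u z} → outside z ≡ true → M u z ≡ E u z
    M-outside {u} {z} z-out with outside-sound {z} z-out
    ... | z≢p , z≢q , z≢r , z≢s =
      sym (trans (E≡M+P u z) (trans (cong (M u z +_) (matching-≢ {x = u} z≢p z≢q z≢r z≢s)) (+-identityʳ _)))

    zeroˡ : ∀ {a} b → a ≡ 0 → a * b ≡ 0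
    zeroˡ b a≡0 = cong (_* b) a≡0

    zeroʳ : ∀ a {b} → b ≡ 0 → a * b ≡ 0
    zeroʳ a b≡0 = trans (cong (a *_) b≡0) (*-zeroʳ a)

    codegree-outside : ∀ u v → M u p * M v p + M u q * M v q + (M u r * M v r + M u s * M v s) ≡ 0 →
                       codegree M u v ≡ count (λ z → N u z ∧ N v z)
    codegree-outside u v on-cycle≡0 = begin
      codegree M u v
        ≡⟨ ∑-split (λ z → M u z * M v z) ⟩
      M u p * M v p + M u q * M v q + (M u r * M v r + M u s * M v s) + ∑[ z < n ] (toℕ (outside z) * (M u z * M v z))
        ≡⟨ cong₂ _+_ on-cycle≡0 (sum-cong-≗ off-cycle) ⟩
      count (λ z → N u z ∧ N v z) ∎
      where
      open ≡-Reasoning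
      off-cycle : ∀ z → toℕ (outside z) * (M u z * M v z) ≡ toℕ (N u z ∧ N v z)
      off-cycle z with outside z in z-out
      ... | false = refl
      ... | true  = begin
        1 * (M u z * M v z)   ≡⟨ *-identityˡ _ ⟩
        M u z * M v z         ≡⟨ cong₂ _*_ (M-outside z-out) (M-outside z-out) ⟩
        E u z * E v z         ≡⟨ sym (toℕ-∧ (e u z) (e v z)) ⟩
        toℕ (e u z ∧ e v z)   ∎

  codegree-pq : codegree M p q ≡ count (λ z → N p z ∧ N q z)
  codegree-pq = codegree-outside p q (cong₂ _+_
    (cong₂ _+_ (zeroˡ (M q p) (M-irrefl p)) (zeroʳ (M p q) (M-irrefl q)))
    (cong₂ _+_ (zeroʳ (M p r) (M-non-edge qr∉E)) (zeroˡ (M q s) (M-non-edge ps∉E))))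

  codegree-rs : codegree M r s ≡ count (λ z → N r z ∧ N s z)
  codegree-rs = codegree-outside r s (cong₂ _+_
    (cong₂ _+_ (zeroʳ (M r p) (M-non-edge (trans (e-sym s p) ps∉E))) (zeroˡ (M s q) (M-non-edge (trans (e-sym r q) qr∉E))))
    (cong₂ _+_ (zeroˡ (M s r) (M-irrefl r)) (zeroʳ (M r s) (M-irrefl s))))

  codegree-qr : codegree M q r ≡ count (λ z → N q z ∧ N r z)
  codegree-qr = codegree-outside q r (cong₂ _+_
    (cong₂ _+_ (zeroˡ (M r p) (trans (M-sym q p) (M-removed e′pq≡false))) (zeroˡ (M r q) (M-irrefl q)))
    (cong₂ _+_ (zeroʳ (M q r) (M-irrefl r)) (zeroʳ (M q s) (M-removed e′rs≡false))))

  codegree-ps : codegree M p s ≡ count (λ z → N p z ∧ N s z)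
  codegree-ps = codegree-outside p s (cong₂ _+_
    (cong₂ _+_ (zeroˡ (M s p) (M-irrefl p)) (zeroˡ (M s q) (M-removed e′pq≡false)))
    (cong₂ _+_ (zeroʳ (M p r) (trans (M-sym s r) (M-removed e′rs≡false))) (zeroʳ (M p s) (M-irrefl s))))

  degree-split : ∀ u → degree E u ≡ E u p + E u q + (E u r + E u s) + count (N u)
  degree-split u =
    trans (∑-split (E u)) (cong (E u p + E u q + (E u r + E u s) +_) (sum-cong-≗ λ z → sym (toℕ-∧ (outside z) (e u z))))

  degree-p : degree E p ≡ 1 + E p r + count (N p)
  degree-p rewrite degree-split p | irrefl G p | pq∈E | ps∉E | +-identityʳ (E p r) = refl

  degree-q : degree E q ≡ 1 + E q s + count (N q)
  degree-q rewrite degree-split q | e-sym q p | pq∈E | irrefl G q | qr∉E = refl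

  degree-r : degree E r ≡ 1 + E r p + count (N r)
  degree-r rewrite degree-split r | e-sym r q | qr∉E | irrefl G r | rs∈E = shift (E r p) (count (N r))
    where
    shift : ∀ k c → k + 0 + (0 + 1) + c ≡ 1 + k + c
    shift = solve-∀

  degree-s : degree E s ≡ 1 + E s q + count (N s)
  degree-s rewrite degree-split s | e-sym s p | ps∉E | e-sym s r | rs∈E | irrefl G s = shift (E s q) (count (N s))
    where
    shift : ∀ k c → k + (1 + 0) + c ≡ 1 + k + c
    shift = solve-∀

  private
    distinct-qrps : Distinct q r p s
    distinct-qrps = record { a≢b = q≢r ; a≢c = ≢-sym p≢q ; a≢d = q≢s ; b≢c = ≢-sym p≢r ; b≢d = r≢s ; c≢d = p≢s }

  module _ (iso : Isomorphic e′ e) where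
    private
      σ = proj₁ iso

      π : Fin n → Fin n
      π = Inverse.to σ

      E′≡E∘π : ∀ x y → E′ x y ≡ E (π x) (π y)
      E′≡E∘π x y = cong toℕ (sym (proj₂ iso x y))

    triangle-balance : TriangleBalance (N p) (N q) (N r) (N s)
    triangle-balance = balanced (begin
      count (λ z → N p z ∧ N q z) + count (λ z → N r z ∧ N s z)  ≡⟨ sym (cong₂ _+_ codegree-pq codegree-rs) ⟩
      codegree M p q + codegree M r s                            ≡⟨ *-cancelˡ-≡ _ _ 6 (+-cancelˡ-≡ (triangles M) _ _ six-codegrees) ⟩
      codegree M q r + codegree M p s                            ≡⟨ cong₂ _+_ codegree-qr codegree-ps ⟩
      count (λ z → N q z ∧ N r z) + count (λ z → N p z ∧ N s z)  ∎)
      where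
      open ≡-Reasoning
      six-codegrees : triangles M + 6 * (codegree M p q + codegree M r s) ≡ triangles M + 6 * (codegree M q r + codegree M p s)
      six-codegrees = begin
        triangles M + 6 * (codegree M p q + codegree M r s)  ≡⟨ sym (triangles-+-matching M M-sym M-irrefl distinct E E≡M+P) ⟩
        triangles E                                          ≡⟨ sym (triangles-reindex σ E) ⟩
        triangles (λ x y → E (π x) (π y))
          ≡⟨ ∑³-cong (λ x y z → sym (cong₂ _*_ (E′≡E∘π x y) (cong₂ _*_ (E′≡E∘π x z) (E′≡E∘π y z)))) ⟩
        triangles E′                                         ≡⟨ triangles-+-matching M M-sym M-irrefl distinct-qrps E′ E′≡M+Q ⟩
        triangles M + 6 * (codegree M q r + codegree M p s)  ∎

    degree-invariant : ∀ x → degree E (π x) ≡ degree E x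
    degree-invariant x = begin
      degree E (π x)                                  ≡⟨ sym (∑-reindex σ (E (π x))) ⟩
      ∑[ y < n ] E (π x) (π y)                        ≡⟨ sum-cong-≗ (λ y → sym (E′≡E∘π x y)) ⟩
      degree E′ x                                     ≡⟨ sum-cong-≗ (E′≡M+Q x) ⟩
      ∑[ y < n ] (M x y + Q x y)                      ≡⟨ row-sum Q (∑-matching-row q r p s x) ⟩
      degree M x + (δ x q + δ x r + (δ x p + δ x s))  ≡⟨ cong (degree M x +_) (rotate (δ x p) (δ x q) (δ x r) (δ x s)) ⟩
      degree M x + (δ x p + δ x q + (δ x r + δ x s))  ≡⟨ sym (row-sum P (∑-matching-row p q r s x)) ⟩
      ∑[ y < n ] (M x y + P x y)                      ≡⟨ sum-cong-≗ (λ y → sym (E≡M+P x y)) ⟩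
      degree E x                                      ∎
      where
      open ≡-Reasoning
      rotate : ∀ a b c d → b + c + (a + d) ≡ a + b + (c + d)
      rotate = solve-∀
      row-sum : ∀ D {k} → ∑[ y < n ] D x y ≡ k → ∑[ y < n ] (M x y + D x y) ≡ degree M x + k
      row-sum D ∑D≡k = trans (∑-distrib-+ (M x) (D x)) (cong (degree M x +_) ∑D≡k)

    opposite-degrees : degree E p ≡ degree E r ⊎ degree E q ≡ degree E s
    opposite-degrees = m*n+o*p≡n*o+m*p⇒m≡o⊎n≡p (d p) (d q) (d r) (d s)
      (*-cancelˡ-≡ _ _ 2 (+-cancelˡ-≡ (weighted M) _ _ (begin
        weighted M + 2 * (d p * d q + d r * d s)        ≡⟨ cong (weighted M +_) (double (d p) (d q) (d r) (d s)) ⟩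
        weighted M + (h p q + h q p + (h r s + h s r))  ≡⟨ sym (∑²-+-matching p q r s {M} E≡M+P h) ⟩
        weighted E                                      ≡⟨ sym (∑²-reindex σ (λ x y → E x y * h x y)) ⟩
        ∑² (λ x y → E (π x) (π y) * h (π x) (π y))      ≡⟨ ∑²-cong (λ x y → cong₂ _*_ (sym (E′≡E∘π x y))
                                                                     (cong₂ _*_ (degree-invariant x) (degree-invariant y))) ⟩
        weighted E′                                     ≡⟨ ∑²-+-matching q r p s {M} E′≡M+Q h ⟩
        weighted M + (h q r + h r q + (h p s + h s p))  ≡⟨ cong (weighted M +_) (sym (double (d q) (d r) (d p) (d s))) ⟩
        weighted M + 2 * (d q * d r + d p * d s)        ∎)))
      where
      open ≡-Reasoning
      d : Fin n → ℕ
      d = degree E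
      h : Fin n → Fin n → ℕ
      h x y = d x * d y
      weighted : (Fin n → Fin n → ℕ) → ℕ
      weighted F = ∑² λ x y → F x y * h x y
      double : ∀ a b c e → 2 * (a * b + c * e) ≡ a * b + b * a + (c * e + e * c)
      double = solve-∀

    degree-balance : count (N p) ≡ count (N r) ⊎ count (N q) ≡ count (N s)
    degree-balance with opposite-degrees
    ... | inj₁ dp≡dr = inj₁ (+-cancelˡ-≡ (1 + E p r) _ _ (begin
      1 + E p r + count (N p)   ≡⟨ sym degree-p ⟩
      degree E p                ≡⟨ dp≡dr ⟩
      degree E r                ≡⟨ degree-r ⟩
      1 + E r p + count (N r)   ≡⟨ cong (λ k → 1 + toℕ k + count (N r)) (e-sym r p) ⟩
      1 + E p r + count (N r)   ∎))
      where open ≡-Reasoning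
    ... | inj₂ dq≡ds = inj₂ (+-cancelˡ-≡ (1 + E q s) _ _ (begin
      1 + E q s + count (N q)   ≡⟨ sym degree-q ⟩
      degree E q                ≡⟨ dq≡ds ⟩
      degree E s                ≡⟨ degree-s ⟩
      1 + E s q + count (N s)   ≡⟨ cong (λ k → 1 + toℕ k + count (N s)) (e-sym s q) ⟩
      1 + E q s + count (N s)   ∎))
      where open ≡-Reasoning

  -- the relabellings of ⟨p,q:r,s⟩ that preserve both {pq, rs} and {qr, ps}
  data Relabelling : Fin n → Fin n → Fin n → Fin n → Set where
    identity : Relabelling p q r s
    swap     : Relabelling q p s r
    reversal : Relabelling s r q p

  relabel-cycle : ∀ {u v w x} → Relabelling u v w x → AlternatingCycle G u v w x
  relabel-cycle identity = cycle
  relabel-cycle swap = record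
    { distinct = record { a≢b = ≢-sym p≢q ; a≢c = q≢s ; a≢d = q≢r ; b≢c = p≢s ; b≢d = p≢r ; c≢d = ≢-sym r≢s }
    ; pq∈E = trans (e-sym q p) pq∈E ; rs∈E = trans (e-sym s r) rs∈E ; qr∉E = ps∉E ; ps∉E = qr∉E }
  relabel-cycle reversal = record
    { distinct = record { a≢b = ≢-sym r≢s ; a≢c = ≢-sym q≢s ; a≢d = ≢-sym p≢s
                        ; b≢c = ≢-sym q≢r ; b≢d = ≢-sym p≢r ; c≢d = ≢-sym p≢q }
    ; pq∈E = trans (e-sym s r) rs∈E ; rs∈E = trans (e-sym q p) pq∈E
    ; qr∉E = trans (e-sym r q) qr∉E ; ps∉E = trans (e-sym s p) ps∉E }

  relabel-outside : ∀ {u v w x y} → Relabelling u v w x → Outside p q r s y → Outside u v w x y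
  relabel-outside identity y-out                   = y-out
  relabel-outside swap     (y≢p , y≢q , y≢r , y≢s) = y≢q , y≢p , y≢s , y≢r
  relabel-outside reversal (y≢p , y≢q , y≢r , y≢s) = y≢s , y≢r , y≢q , y≢p

  relabel-sameCycle : ∀ {u v w x} → Relabelling u v w x → PairSetEq u v w x p q r s × PairSetEq v w u x q r p s
  relabel-sameCycle identity = inj₁ (inj₁ (refl , refl) , inj₁ (refl , refl)) , inj₁ (inj₁ (refl , refl) , inj₁ (refl , refl))
  relabel-sameCycle swap     = inj₁ (inj₂ (refl , refl) , inj₂ (refl , refl)) , inj₂ (inj₁ (refl , refl) , inj₁ (refl , refl))
  relabel-sameCycle reversal = inj₂ (inj₂ (refl , refl) , inj₂ (refl , refl)) , inj₁ (inj₂ (refl , refl) , inj₂ (refl , refl))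

  private
    N⇒adj : ∀ {u z} → N u z ≡ true → e u z ≡ true
    N⇒adj {u} {z} Nuz with outside z
    ... | true = Nuz

    N⇒outside : ∀ {u z} → N u z ≡ true → Outside p q r s z
    N⇒outside {u} {z} Nuz with outside z in z-out
    ... | true = outside-sound z-out

    N⇒non-adj : ∀ {u z} → Outside p q r s z → N u z ≡ false → e u z ≡ false
    N⇒non-adj z-out Nuz = trans (sym (N-outside z-out)) Nuz

  profile : ∀ {a b c d z} → Outside p q r s z → e a z ≡ true → e b z ≡ true → e c z ≡ false → e d z ≡ false →
            (N a ∩ N b ∖ N c ∪ N d) z
  profile z-out az bz cz dz =
    in-out (trans (N-outside z-out) az) (trans (N-outside z-out) bz) (trans (N-outside z-out) cz) (trans (N-outside z-out) dz)

  difference : ∀ {a c z} → Outside p q r s z → e a z ≡ true → e c z ≡ false → (N a ─ N c) z ≡ true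
  difference {a} {c} z-out az cz = ─-intro (N a) (N c) (trans (N-outside z-out) az) (trans (N-outside z-out) cz)

  configA : ∀ {u v w x} → Relabelling u v w x → ∀ {y z} → (N v ∩ N w ∖ N u ∪ N x) y → (N u ∩ N v ∖ N w ∪ N x) z →
            Contains G conf-A (lookup (u ∷ v ∷ w ∷ x ∷ y ∷ z ∷ []))
  configA {u} {v} {w} {x} ρ {y} {z} (in-out vy wy uy xy) (in-out uz vz wz xz) =
    (λ {i} {j} → lookup-injective uvwxyz-distinct i j) ,
    (uv∈E ∷ wx∈E ∷ N⇒adj vy ∷ N⇒adj wy ∷ N⇒adj uz ∷ N⇒adj vz ∷ []) ,
    (vw∉E ∷ ux∉E ∷ N⇒non-adj y-out uy ∷ N⇒non-adj y-out xy ∷ N⇒non-adj z-out wz ∷ N⇒non-adj z-out xz ∷ [])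
    where
    open AlternatingCycle (relabel-cycle ρ)
      renaming (pq∈E to uv∈E; rs∈E to wx∈E; qr∉E to vw∉E; ps∉E to ux∉E;
                p≢q to u≢v; p≢r to u≢w; p≢s to u≢x; q≢r to v≢w; q≢s to v≢x; r≢s to w≢x)
    y-out = N⇒outside vy
    z-out = N⇒outside uz
    uvwxyz-distinct : Unique (u ∷ v ∷ w ∷ x ∷ y ∷ z ∷ [])
    uvwxyz-distinct with relabel-outside ρ y-out | relabel-outside ρ z-out
    ... | y≢u , y≢v , y≢w , y≢x | z≢u , z≢v , z≢w , z≢x =
      (u≢v ∷ u≢w ∷ u≢x ∷ ≢-sym y≢u ∷ ≢-sym z≢u ∷ []) ∷
      (v≢w ∷ v≢x ∷ ≢-sym y≢v ∷ ≢-sym z≢v ∷ []) ∷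
      (w≢x ∷ ≢-sym y≢w ∷ ≢-sym z≢w ∷ []) ∷
      (≢-sym y≢x ∷ ≢-sym z≢x ∷ []) ∷
      (separated {A = N u} uy uz ∷ []) ∷ [] ∷ []

  configB : ∀ {u v w x} → Relabelling u v w x → ∀ {y z t} →
            (N v ─ N x) y ≡ true → (N u ─ N w) z ≡ true → (N w ─ N u) t ≡ true → y ≢ z → y ≢ t →
            Contains G conf-B (lookup (u ∷ v ∷ w ∷ x ∷ y ∷ z ∷ t ∷ []))
  configB {u} {v} {w} {x} ρ {y} {z} {t} y∈v─x z∈u─w t∈w─u y≢z y≢t =
    (λ {i} {j} → lookup-injective uvwxyzt-distinct i j) ,
    (uv∈E ∷ wx∈E ∷ N⇒adj vy ∷ N⇒adj uz ∷ N⇒adj wt ∷ []) ,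
    (vw∉E ∷ ux∉E ∷ N⇒non-adj y-out xy ∷ N⇒non-adj z-out wz ∷ N⇒non-adj t-out ut ∷ [])
    where
    open AlternatingCycle (relabel-cycle ρ)
      renaming (pq∈E to uv∈E; rs∈E to wx∈E; qr∉E to vw∉E; ps∉E to ux∉E;
                p≢q to u≢v; p≢r to u≢w; p≢s to u≢x; q≢r to v≢w; q≢s to v≢x; r≢s to w≢x)
    vy = proj₁ (─-elim (N v) (N x) y∈v─x)
    xy = proj₂ (─-elim (N v) (N x) y∈v─x)
    uz = proj₁ (─-elim (N u) (N w) z∈u─w)
    wz = proj₂ (─-elim (N u) (N w) z∈u─w)
    wt = proj₁ (─-elim (N w) (N u) t∈w─u)
    ut = proj₂ (─-elim (N w) (N u) t∈w─u)
    y-out = N⇒outside vy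
    z-out = N⇒outside uz
    t-out = N⇒outside wt
    uvwxyzt-distinct : Unique (u ∷ v ∷ w ∷ x ∷ y ∷ z ∷ t ∷ [])
    uvwxyzt-distinct with relabel-outside ρ y-out | relabel-outside ρ z-out | relabel-outside ρ t-out
    ... | y≢u , y≢v , y≢w , y≢x | z≢u , z≢v , z≢w , z≢x | t≢u , t≢v , t≢w , t≢x =
      (u≢v ∷ u≢w ∷ u≢x ∷ ≢-sym y≢u ∷ ≢-sym z≢u ∷ ≢-sym t≢u ∷ []) ∷
      (v≢w ∷ v≢x ∷ ≢-sym y≢v ∷ ≢-sym z≢v ∷ ≢-sym t≢v ∷ []) ∷
      (w≢x ∷ ≢-sym y≢w ∷ ≢-sym z≢w ∷ ≢-sym t≢w ∷ []) ∷
      (≢-sym y≢x ∷ ≢-sym z≢x ∷ ≢-sym t≢x ∷ []) ∷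
      (y≢z ∷ y≢t ∷ []) ∷
      (≢-sym (separated {A = N u} ut uz) ∷ []) ∷ [] ∷ []

-- The configurations

Result : ∀ {n} → Graph n → (C : Config) → (Fin (size C) → Fin n) → Set
Result {n} G C f =
  Σ Config λ D → BigConfig D × Σ (Fin (size D) → Fin n) λ g → Contains G D g × ImageSub f g × SameCycle C D f g

module ImageCycle {n} (G : Graph n) {k} (f : Fin (4 + k) → Fin n) (f-inj : Injective _≡_ _≡_ f)
                  (pq∈E : adj G (f 0F) (f 1F) ≡ true) (rs∈E : adj G (f 2F) (f 3F) ≡ true)
                  (qr∉E : adj G (f 1F) (f 2F) ≡ false) (ps∉E : adj G (f 0F) (f 3F) ≡ false) where

  p q r s : Fin n
  p = f 0F
  q = f 1F
  r = f 2F
  s = f 3F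

  image-≢ : ∀ {i j} → i ≢ j → f i ≢ f j
  image-≢ i≢j fi≡fj = i≢j (f-inj fi≡fj)

  cycle : AlternatingCycle G p q r s
  cycle = record
    { distinct = record { a≢b = image-≢ λ () ; a≢c = image-≢ λ () ; a≢d = image-≢ λ ()
                        ; b≢c = image-≢ λ () ; b≢d = image-≢ λ () ; c≢d = image-≢ λ () }
    ; pq∈E = pq∈E ; rs∈E = rs∈E ; qr∉E = qr∉E ; ps∉E = ps∉E }

  open Switch G cycle public

  outside-image : ∀ i → Outside p q r s (f (4 ↑ʳ i))
  outside-image i = image-≢ (λ ()) , image-≢ (λ ()) , image-≢ (λ ()) , image-≢ (λ ())

theorem2p3-a : ∀ {n} (G : Graph n) (f : Fin 5 → Fin n) → Contains G conf-a f →
               Isomorphic (switchAdj (adj G) (f 0F) (f 1F) (f 2F) (f 3F)) (adj G) → Result G conf-a f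
theorem2p3-a G f (f-inj , (pq ∷ rs ∷ qw ∷ rw ∷ []) , (qr ∷ ps ∷ pw ∷ sw ∷ [])) iso =
  from-parallel (crossing⇒parallel (triangle-balance iso) w-profile)
  where
  open ImageCycle G f f-inj pq rs qr ps
  w = f 4F
  w-profile : (N q ∩ N r ∖ N p ∪ N s) w
  w-profile = profile (outside-image 0F) qw rw pw sw
  from-parallel : ∃ (λ z → (N p ∩ N q ∖ N r ∪ N s) z ⊎ (N r ∩ N s ∖ N p ∪ N q) z) → Result G conf-a f
  from-parallel (z , inj₁ z-profile) =
    conf-A , is-A , lookup (p ∷ q ∷ r ∷ s ∷ w ∷ z ∷ []) ,
    configA identity w-profile z-profile ,
    (λ { 0F → 0F , refl ; 1F → 1F , refl ; 2F → 2F , refl ; 3F → 3F , refl ; 4F → 4F , refl }) ,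
    relabel-sameCycle identity
  from-parallel (z , inj₂ z-profile) =
    conf-A , is-A , lookup (s ∷ r ∷ q ∷ p ∷ w ∷ z ∷ []) ,
    configA reversal (∩-comm (∪-comm w-profile)) (∩-comm (∪-comm z-profile)) ,
    (λ { 0F → 3F , refl ; 1F → 2F , refl ; 2F → 1F , refl ; 3F → 0F , refl ; 4F → 4F , refl }) ,
    relabel-sameCycle reversal

theorem2p3-b : ∀ {n} (G : Graph n) (f : Fin 5 → Fin n) → Contains G conf-b f →
               Isomorphic (switchAdj (adj G) (f 0F) (f 1F) (f 2F) (f 3F)) (adj G) → Result G conf-b f
theorem2p3-b G f (f-inj , (pq ∷ rs ∷ pw ∷ qw ∷ []) , (qr ∷ ps ∷ rw ∷ sw ∷ [])) iso =
  from-crossing (crossing⇒parallel (TriangleBalance-reflect (triangle-balance iso)) (∩-comm w-profile))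
  where
  open ImageCycle G f f-inj pq rs qr ps
  w = f 4F
  w-profile : (N p ∩ N q ∖ N r ∪ N s) w
  w-profile = profile (outside-image 0F) pw qw rw sw
  from-crossing : ∃ (λ z → (N r ∩ N q ∖ N p ∪ N s) z ⊎ (N p ∩ N s ∖ N r ∪ N q) z) → Result G conf-b f
  from-crossing (z , inj₁ z-profile) =
    conf-A , is-A , lookup (p ∷ q ∷ r ∷ s ∷ z ∷ w ∷ []) ,
    configA identity (∩-comm z-profile) w-profile ,
    (λ { 0F → 0F , refl ; 1F → 1F , refl ; 2F → 2F , refl ; 3F → 3F , refl ; 4F → 5F , refl }) ,
    relabel-sameCycle identity
  from-crossing (z , inj₂ z-profile) =
    conf-A , is-A , lookup (q ∷ p ∷ s ∷ r ∷ z ∷ w ∷ []) ,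
    configA swap (∪-comm z-profile) (∩-comm (∪-comm w-profile)) ,
    (λ { 0F → 1F , refl ; 1F → 0F , refl ; 2F → 3F , refl ; 3F → 2F , refl ; 4F → 5F , refl }) ,
    relabel-sameCycle swap

theorem2p3-c : ∀ {n} (G : Graph n) (f : Fin 6 → Fin n) → Contains G conf-c f →
               Isomorphic (switchAdj (adj G) (f 0F) (f 1F) (f 2F) (f 3F)) (adj G) → Result G conf-c f
theorem2p3-c G f (f-inj , (pq ∷ rs ∷ pz ∷ qy ∷ []) , (qr ∷ ps ∷ rz ∷ sy ∷ [])) iso = from-degrees (degree-balance iso)
  where
  open ImageCycle G f f-inj pq rs qr ps
  y z : Fin _
  y = f 4F
  z = f 5F
  y≢z : y ≢ z
  y≢z = image-≢ λ ()
  y∈q─s : (N q ─ N s) y ≡ true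
  y∈q─s = difference (outside-image 0F) qy sy
  z∈p─r : (N p ─ N r) z ≡ true
  z∈p─r = difference (outside-image 1F) pz rz
  from-degrees : count (N p) ≡ count (N r) ⊎ count (N q) ≡ count (N s) → Result G conf-c f
  from-degrees (inj₁ |Np|≡|Nr|) = balanced-pr (balanced-difference (triangle-balance iso) |Np|≡|Nr| z∈p─r y∈q─s)
    where
    balanced-pr : BalancedDifference (N p) (N q) (N r) (N s) z y → Result G conf-c f
    balanced-pr (another t t∈r─p t≢y) =
      conf-B , is-B , lookup (p ∷ q ∷ r ∷ s ∷ y ∷ z ∷ t ∷ []) ,
      configB identity y∈q─s z∈p─r t∈r─p y≢z (≢-sym t≢y) ,
      (λ { 0F → 0F , refl ; 1F → 1F , refl ; 2F → 2F , refl ; 3F → 3F , refl ; 4F → 4F , refl ; 5F → 5F , refl }) ,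
      relabel-sameCycle identity
    balanced-pr (exact z-profile y-profile) =
      conf-A , is-A , lookup (p ∷ q ∷ r ∷ s ∷ y ∷ z ∷ []) ,
      configA identity y-profile z-profile ,
      (λ { 0F → 0F , refl ; 1F → 1F , refl ; 2F → 2F , refl ; 3F → 3F , refl ; 4F → 4F , refl ; 5F → 5F , refl }) ,
      relabel-sameCycle identity
  from-degrees (inj₂ |Nq|≡|Ns|) =
    balanced-qs (balanced-difference (TriangleBalance-swap (triangle-balance iso)) |Nq|≡|Ns| y∈q─s z∈p─r)
    where
    balanced-qs : BalancedDifference (N q) (N p) (N s) (N r) y z → Result G conf-c f
    balanced-qs (another t t∈s─q t≢z) =
      conf-B , is-B , lookup (q ∷ p ∷ s ∷ r ∷ z ∷ y ∷ t ∷ []) ,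
      configB swap z∈p─r y∈q─s t∈s─q (≢-sym y≢z) (≢-sym t≢z) ,
      (λ { 0F → 1F , refl ; 1F → 0F , refl ; 2F → 3F , refl ; 3F → 2F , refl ; 4F → 5F , refl ; 5F → 4F , refl }) ,
      relabel-sameCycle swap
    balanced-qs (exact y-profile z-profile) =
      conf-A , is-A , lookup (q ∷ p ∷ s ∷ r ∷ z ∷ y ∷ []) ,
      configA swap z-profile y-profile ,
      (λ { 0F → 1F , refl ; 1F → 0F , refl ; 2F → 3F , refl ; 3F → 2F , refl ; 4F → 5F , refl ; 5F → 4F , refl }) ,
      relabel-sameCycle swap

theorem2p3-d : ∀ {n} (G : Graph n) (f : Fin 6 → Fin n) → Contains G conf-d f →
               Isomorphic (switchAdj (adj G) (f 0F) (f 1F) (f 2F) (f 3F)) (adj G) → Result G conf-d f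
theorem2p3-d G f (f-inj , (pq ∷ rs ∷ ry ∷ qz ∷ []) , (qr ∷ ps ∷ py ∷ sz ∷ [])) iso = from-degrees (degree-balance iso)
  where
  open ImageCycle G f f-inj pq rs qr ps
  y z : Fin _
  y = f 4F
  z = f 5F
  y≢z : y ≢ z
  y≢z = image-≢ λ ()
  y∈r─p : (N r ─ N p) y ≡ true
  y∈r─p = difference (outside-image 0F) ry py
  z∈q─s : (N q ─ N s) z ≡ true
  z∈q─s = difference (outside-image 1F) qz sz
  from-degrees : count (N p) ≡ count (N r) ⊎ count (N q) ≡ count (N s) → Result G conf-d f
  from-degrees (inj₁ |Np|≡|Nr|) =
    balanced-pr (balanced-difference (TriangleBalance-reflect (triangle-balance iso)) (sym |Np|≡|Nr|) y∈r─p z∈q─s)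
    where
    balanced-pr : BalancedDifference (N r) (N q) (N p) (N s) y z → Result G conf-d f
    balanced-pr (another t t∈p─r t≢z) =
      conf-B , is-B , lookup (p ∷ q ∷ r ∷ s ∷ z ∷ t ∷ y ∷ []) ,
      configB identity z∈q─s t∈p─r y∈r─p (≢-sym t≢z) (≢-sym y≢z) ,
      (λ { 0F → 0F , refl ; 1F → 1F , refl ; 2F → 2F , refl ; 3F → 3F , refl ; 4F → 6F , refl ; 5F → 4F , refl }) ,
      relabel-sameCycle identity
    balanced-pr (exact y-profile z-profile) =
      conf-A , is-A , lookup (p ∷ q ∷ r ∷ s ∷ y ∷ z ∷ []) ,
      configA identity (∩-comm y-profile) (∩-comm z-profile) ,
      (λ { 0F → 0F , refl ; 1F → 1F , refl ; 2F → 2F , refl ; 3F → 3F , refl ; 4F → 4F , refl ; 5F → 5F , refl }) ,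
      relabel-sameCycle identity
  from-degrees (inj₂ |Nq|≡|Ns|) =
    balanced-qs (balanced-difference (TriangleBalance-rotate (triangle-balance iso)) |Nq|≡|Ns| z∈q─s y∈r─p)
    where
    balanced-qs : BalancedDifference (N q) (N r) (N s) (N p) z y → Result G conf-d f
    balanced-qs (another t t∈s─q t≢y) =
      conf-B , is-B , lookup (s ∷ r ∷ q ∷ p ∷ y ∷ t ∷ z ∷ []) ,
      configB reversal y∈r─p t∈s─q z∈q─s (≢-sym t≢y) y≢z ,
      (λ { 0F → 3F , refl ; 1F → 2F , refl ; 2F → 1F , refl ; 3F → 0F , refl ; 4F → 4F , refl ; 5F → 6F , refl }) ,
      relabel-sameCycle reversal
    balanced-qs (exact z-profile y-profile) =
      conf-A , is-A , lookup (s ∷ r ∷ q ∷ p ∷ z ∷ y ∷ []) ,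
      configA reversal (∩-comm z-profile) (∩-comm y-profile) ,
      (λ { 0F → 3F , refl ; 1F → 2F , refl ; 2F → 1F , refl ; 3F → 0F , refl ; 4F → 5F , refl ; 5F → 4F , refl }) ,
      relabel-sameCycle reversal

theorem2p3 : ∀ {n} (G : Graph n) (C : Config) → SmallConfig C →
    (f : Fin (size C) → Fin n) → Contains G C f →
    Isomorphic (switchAdj (adj G) (f (c₁ C)) (f (c₂ C)) (f (c₃ C)) (f (c₄ C))) (adj G) →
    Σ Config λ D → BigConfig D × Σ (Fin (size D) → Fin n) λ g →
      Contains G D g × ImageSub f g × SameCycle C D f g
theorem2p3 G _ is-a = theorem2p3-a G
theorem2p3 G _ is-b = theorem2p3-b G
theorem2p3 G _ is-c = theorem2p3-c G
theorem2p3 G _ is-d = theorem2p3-d G
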